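{- Let $r\geq3$, $k\geq1$ be integers and $0<\varepsilon<\frac{1}{36r^8}$. For every sufficiently large $n$ (depending on $r,k,\varepsilon$), let $G$ be an $n$-vertex graph with the maximum number of edges among all non-$r$-partite $B_{r,k}$-free graphs on $n$ vertices, let $V(G)=V_1\cup\cdots\cup V_r$ be a partition maximizing $\sum_{1\leq i<j\leq r}e(V_i,V_j)$ and satisfying $\sum_{i=1}^re(V_i)\leq\frac{\varepsilon}{2}n^2$ and $\left(\frac1r-2\sqrt\varepsilon\right)n<|V_i|<\left(\frac1r+2\sqrt\varepsilon\right)n$ for all $i\in[r]$, and let $L=\{v\in V(G): d_G(v)\leq (1-\frac1r-5\sqrt\varepsilon)n\}$. Then $e(V_i\setminus L)=0$ for each $i\in[r]$.
   Context: $B_{r,k}=K_r\vee kK_1$ is the graph obtained by joining every vertex of a $K_r$ to every vertex of an independent set of size $k$. A graph is $r$-partite if its vertex set can be partitioned into $r$ (possibly empty) independent sets. $e(A)$ is the number of edges of $G$ with both ends in $A$, $e(A,B)$ the number of edges between disjoint sets $A,B$.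
   Formalization: The parameter ε takes only rational values. -}

module Defs where

open import Data.Nat as ℕ using (ℕ; zero; suc; _≡ᵇ_; _<ᵇ_)
open import Data.Fin using (Fin; toℕ)
open import Data.Fin.Properties using () renaming (_≟_ to _≟F_)
open import Data.Bool using (Bool; true; false; _∧_; _∨_; not; if_then_else_)
open import Data.List using (List; []; _∷_; allFin; map; concatMap)
open import Data.Nat.ListAction using (sum)
open import Data.Sum using (_⊎_)
open import Data.Product using (Σ; ∃; _×_; _,_)
open import Data.Integer using (+_)
open import Data.Rational using (ℚ; 0ℚ; _/_; _≤_; _<_; _*_; _-_; _+_)
open import Data.Rational.Properties using (_≤?_)
open import Relation.Nullary using (¬_; does)
open import Relation.Binary.PropositionalEquality using (_≡_; _≢_)
open import Function.Definitions using (Injective)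

record Graph (n : ℕ) : Set where
  field
    adj    : Fin n → Fin n → Bool
    sym    : ∀ u v → adj u v ≡ adj v u
    irrefl : ∀ v → adj v v ≡ false
open Graph public

_==_ : ∀ {n} → Fin n → Fin n → Bool
u == v = does (u ≟F v)

count : ∀ {A : Set} → (A → Bool) → List A → ℕ
count p []       = 0
count p (x ∷ xs) = if p x then suc (count p xs) else count p xs

vpairs : (n : ℕ) → List (Fin n × Fin n)
vpairs n = concatMap (λ u → concatMap (λ v → if toℕ u <ᵇ toℕ v then (u , v) ∷ [] else []) (allFin n)) (allFin n)

eIn : ∀ {n} → Graph n → (Fin n → Bool) → ℕ
eIn {n} G A = count (λ { (u , v) → adj G u v ∧ A u ∧ A v }) (vpairs n)

eBetween : ∀ {n} → Graph n → (Fin n → Bool) → (Fin n → Bool) → ℕ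
eBetween {n} G A B =
  count (λ { (u , v) → adj G u v ∧ ((A u ∧ B v) ∨ (B u ∧ A v)) }) (vpairs n)

edges : ∀ {n} → Graph n → ℕ
edges G = eIn G (λ _ → true)

deg : ∀ {n} → Graph n → Fin n → ℕ
deg {n} G v = count (adj G v) (allFin n)

card : ∀ {n} → (Fin n → Bool) → ℕ
card {n} A = count A (allFin n)

-- r-partite: vertex set partitioned into r (possibly empty) independent
-- sets, encoded by a colouring Fin n → Fin r.

RPartite : ∀ {n} → ℕ → Graph n → Set
RPartite {n} r G =
  Σ (Fin n → Fin r) λ c → ∀ u v → adj G u v ≡ true → c u ≢ c v

Contains : ∀ {n} (m : ℕ) → (Fin m → Fin m → Bool) → Graph n → Set
Contains {n} m H G =
  Σ (Fin m → Fin n) λ f → Injective _≡_ _≡_ f ×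
    (∀ a b → H a b ≡ true → adj G (f a) (f b) ≡ true)

-- B_{r,k} = K_r ∨ kK_1 on vertex set Fin (r + k): the vertices with index
-- < r form the K_r, the others the independent set of size k.
Badj : (r k : ℕ) → Fin (r ℕ.+ k) → Fin (r ℕ.+ k) → Bool
Badj r k a b = not (toℕ a ≡ᵇ toℕ b) ∧ ((toℕ a <ᵇ r) ∨ (toℕ b <ᵇ r))

BFree : ∀ {n} → (r k : ℕ) → Graph n → Set
BFree r k G = ¬ Contains (r ℕ.+ k) (Badj r k) G

Extremal : ∀ {n} → (r k : ℕ) → Graph n → Set
Extremal {n} r k G =
  (¬ RPartite r G) × BFree r k G ×
  (∀ (H : Graph n) → ¬ RPartite r H → BFree r k H → edges H ℕ.≤ edges G)

-- Partitions V(G) = V_1 ∪ ... ∪ V_r, encoded by c : Fin n → Fin r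
-- (V_i = c⁻¹(i)).

part : ∀ {n r} → (Fin n → Fin r) → Fin r → Fin n → Bool
part c i v = c v == i

crossSum : ∀ {n r} → Graph n → (Fin n → Fin r) → ℕ
crossSum {n} {r} G c =
  sum (map (λ i → sum (map (λ j → if toℕ i <ᵇ toℕ j then eBetween G (part c i) (part c j) else 0)
                           (allFin r)))
           (allFin r))

inSum : ∀ {n r} → Graph n → (Fin n → Fin r) → ℕ
inSum {n} {r} G c = sum (map (λ i → eIn G (part c i)) (allFin r))

-- Rational arithmetic helpers.  ℚ has no square roots, so comparisons
-- with b·√ε (b ≥ 0, ε > 0) are expressed exactly by squaring:

ℕtoℚ : ℕ → ℚ
ℕtoℚ m = (+ m) / 1

-- 1/r  (r ≥ 1; the value at 0 is irrelevant)
recip : ℕ → ℚ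
recip zero    = 0ℚ
recip (suc m) = (+ 1) / suc m

-- a < b·√ε      (for b > 0, ε > 0)
LtSqrt : ℚ → ℚ → ℚ → Set
LtSqrt a b ε = (a < 0ℚ) ⊎ (a * a < b * b * ε)

-- b·√ε ≤ a      (for b ≥ 0, ε > 0)
SqrtLe : ℚ → ℚ → ℚ → Set
SqrtLe b ε a = (0ℚ ≤ a) × (b * b * ε ≤ a * a)

sqrtLeᵇ : ℚ → ℚ → ℚ → Bool
sqrtLeᵇ b ε a = does (0ℚ ≤? a) ∧ does ((b * b * ε) ≤? (a * a))

-- L = { v : d_G(v) ≤ (1 - 1/r - 5√ε) n },  i.e.  5n·√ε ≤ (1 - 1/r) n - d(v)
inL : ∀ {n} → (r : ℕ) → ℚ → Graph n → Fin n → Bool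
inL {n} r ε G v =
  sqrtLeᵇ (ℕtoℚ 5 * ℕtoℚ n) ε
          ((ℕtoℚ 1 - recip r) * ℕtoℚ n - ℕtoℚ (deg G v))

{-# OPTIONS --safe #-}
-- Put r = r′ + 2 and Q = 6 r⁴, so that √ε < 1 / Q; after clearing √ε and denominators, every
-- hypothesis becomes an inequality between natural numbers.
-- Blowing up C₅ ∨ K_{r′} along the partition, with the 5-cycle running through V₀ and V₁, gives a
-- graph H that is not r-partite and is K_{r+1}-free, hence B_{r,k}-free, and that misses only O(n)
-- cross pairs. By extremality e(H) ≤ e(G), so G misses at most 2 Σ e(V_i) + 4n cross pairs, and all
-- but O(Q²) vertices are good: they miss at most n / Q vertices outside their own part.
-- A clique whose common neighbourhood is large in every remaining part can be extended greedily by
-- good vertices, one part at a time, to an r-clique with k common neighbours, i.e. a copy of B_{r,k}.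
-- Since the cut is maximum, no vertex has more neighbours in its own part than in another one; for a
-- single vertex this bounds the degree into its own part by O(n / Q), and then an edge uv inside a
-- part with u, v ∉ L would extend to a copy of B_{r,k}.
module Submission where

module Counting where

  open import Defs using (count; vpairs; _==_)
  open import Data.Bool using (Bool; true; false; _∧_; _∨_; not; if_then_else_)
  open import Data.Empty using (⊥; ⊥-elim)
  open import Data.Fin using (Fin; zero; suc; toℕ)
  open import Data.Fin.Properties using (_≟_)
  import Data.Fin.Properties as Fin
  open import Function.Definitions using (Injective)
  open import Data.List using (List; []; _∷_; _++_; allFin; tabulate; concatMap; map)
  open import Data.List.Properties using (map-tabulate)
  import Data.Nat.ListAction as List
  open import Data.Nat using (ℕ; zero; suc; _+_; _*_; _≤_; _<_; _<ᵇ_; z≤n)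
  open import Data.Nat.Properties hiding (_≟_)
  open import Data.Product using (Σ; _×_; _,_)
  open import Function using (_∘_; mk⇔)
  open import Relation.Binary.PropositionalEquality
  open import Relation.Nullary using (yes)
  open import Relation.Nullary.Decidable using (dec-true; dec-false; does-⇔)

  open import Algebra.Properties.Semiring.Sum +-*-semiring public
    using (sum; sum-syntax; sum-cong-≗; ∑-distrib-+; ∑-comm; *-distribˡ-sum; sum-replicate-zero)

  𝟙 : Bool → ℕ
  𝟙 true  = 1
  𝟙 false = 0

  𝟙-∧ : ∀ a b → 𝟙 (a ∧ b) ≡ 𝟙 a * 𝟙 b
  𝟙-∧ true  b = sym (+-identityʳ (𝟙 b))
  𝟙-∧ false b = refl

  𝟙-split : ∀ a b → 𝟙 a ≡ 𝟙 (a ∧ b) + 𝟙 (a ∧ not b)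
  𝟙-split true  true  = refl
  𝟙-split true  false = refl
  𝟙-split false b     = refl

  𝟙-∧-≤ʳ : ∀ a b → 𝟙 (a ∧ b) ≤ 𝟙 b
  𝟙-∧-≤ʳ true  b = ≤-refl
  𝟙-∧-≤ʳ false b = z≤n

  ∧-≡true : ∀ {a b} → (a ∧ b) ≡ true → a ≡ true × b ≡ true
  ∧-≡true {true} {true} _ = refl , refl

  not≡true⇒≡false : ∀ {b} → not b ≡ true → b ≡ false
  not≡true⇒≡false {false} _ = refl

  not≡false⇒≡true : ∀ {b} → not b ≡ false → b ≡ true
  not≡false⇒≡true {true} _ = refl

  𝟙-∨-disjoint : ∀ p q → (p ≡ true → q ≡ true → ⊥) → 𝟙 (p ∨ q) ≡ 𝟙 p + 𝟙 q
  𝟙-∨-disjoint true  true  h = ⊥-elim (h refl refl)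
  𝟙-∨-disjoint true  false _ = refl
  𝟙-∨-disjoint false q     _ = refl

  ==-refl : ∀ {n} (x : Fin n) → (x == x) ≡ true
  ==-refl x = dec-true (x ≟ x) refl

  ==⇒≡ : ∀ {n} {x y : Fin n} → (x == y) ≡ true → x ≡ y
  ==⇒≡ {x = x} {y} eq with x ≟ y | eq
  ... | yes x≡y | _ = x≡y

  ≢⇒==-false : ∀ {n} {x y : Fin n} → x ≢ y → (x == y) ≡ false
  ≢⇒==-false {x = x} {y} = dec-false (x ≟ y)

  ==-false⇒≢ : ∀ {n} {x y : Fin n} → (x == y) ≡ false → x ≢ y
  ==-false⇒≢ {x = x} eq refl with () ← trans (sym (==-refl x)) eq

  ==-sym : ∀ {n} (x y : Fin n) → (x == y) ≡ (y == x)
  ==-sym x y = does-⇔ (mk⇔ sym sym) (x ≟ y) (y ≟ x)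

  ∑-mono-≤ : ∀ {n} {f g : Fin n → ℕ} → (∀ i → f i ≤ g i) → ∑[ i < n ] f i ≤ ∑[ i < n ] g i
  ∑-mono-≤ {zero}  f≤g = z≤n
  ∑-mono-≤ {suc n} f≤g = +-mono-≤ (f≤g zero) (∑-mono-≤ (f≤g ∘ suc))

  ∑-const : ∀ n k → ∑[ _ < n ] k ≡ n * k
  ∑-const zero    k = refl
  ∑-const (suc n) k = cong (k +_) (∑-const n k)

  ∑-pick : ∀ {n} (x : Fin n) (h : Fin n → ℕ) → ∑[ i < n ] (𝟙 (x == i) * h i) ≡ h x
  ∑-pick {suc n} zero    h = trans (cong₂ _+_ (+-identityʳ (h zero)) (sum-replicate-zero n)) (+-identityʳ (h zero))
  ∑-pick {suc n} (suc x) h = ∑-pick x (h ∘ suc)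

  ∑-pickʳ : ∀ {n} (x : Fin n) (h : Fin n → ℕ) → ∑[ i < n ] (𝟙 (i == x) * h i) ≡ h x
  ∑-pickʳ x h = trans (sum-cong-≗ (λ i → cong (λ b → 𝟙 b * h i) (==-sym i x))) (∑-pick x h)

  ∑∑-distrib-+ : ∀ {n} (F H : Fin n → Fin n → ℕ) →
    ∑[ a < n ] ∑[ b < n ] (F a b + H a b) ≡ ∑[ a < n ] ∑[ b < n ] F a b + ∑[ a < n ] ∑[ b < n ] H a b
  ∑∑-distrib-+ {n} F H = trans (sum-cong-≗ {n} λ a → ∑-distrib-+ {n} (F a) (H a)) (∑-distrib-+ {n} _ _)

  sum-tabulate : ∀ {n} (h : Fin n → ℕ) → List.sum (tabulate h) ≡ ∑[ i < n ] h i
  sum-tabulate {zero}  h = refl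
  sum-tabulate {suc n} h = cong (h zero +_) (sum-tabulate (h ∘ suc))

  sum-map-allFin : ∀ {n} (h : Fin n → ℕ) → List.sum (map h (allFin n)) ≡ ∑[ i < n ] h i
  sum-map-allFin h = trans (cong List.sum (map-tabulate (λ i → i) h)) (sum-tabulate h)

  ∑∑-pick : ∀ {r} (X Y : Fin r) (h : Fin r → Fin r → ℕ) →
    ∑[ i < r ] ∑[ j < r ] (𝟙 (X == i) * 𝟙 (Y == j) * h i j) ≡ h X Y
  ∑∑-pick {r} X Y h = trans
    (sum-cong-≗ {r} λ i → trans (sum-cong-≗ {r} λ j → *-assoc (𝟙 (X == i)) _ _)
                         (trans (sym (*-distribˡ-sum {r} (𝟙 (X == i)) _)) (cong (𝟙 (X == i) *_) (∑-pick Y (h i)))))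
    (∑-pick X (λ i → h i Y))

  ∑-comm⁴ : ∀ {r n} (F : Fin r → Fin r → Fin n → Fin n → ℕ) →
    ∑[ i < r ] ∑[ j < r ] ∑[ a < n ] ∑[ b < n ] F i j a b ≡ ∑[ a < n ] ∑[ b < n ] ∑[ i < r ] ∑[ j < r ] F i j a b
  ∑-comm⁴ {r} {n} F = begin
    ∑[ i < r ] ∑[ j < r ] ∑[ a < n ] ∑[ b < n ] F i j a b ≡⟨ sum-cong-≗ {r} (λ i → ∑-comm {r} {n} _) ⟩
    ∑[ i < r ] ∑[ a < n ] ∑[ j < r ] ∑[ b < n ] F i j a b ≡⟨ sum-cong-≗ {r} (λ i → sum-cong-≗ {n} λ a → ∑-comm {r} {n} _) ⟩
    ∑[ i < r ] ∑[ a < n ] ∑[ b < n ] ∑[ j < r ] F i j a b ≡⟨ ∑-comm {r} {n} _ ⟩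
    ∑[ a < n ] ∑[ i < r ] ∑[ b < n ] ∑[ j < r ] F i j a b ≡⟨ sum-cong-≗ {n} (λ a → ∑-comm {r} {n} _) ⟩
    ∑[ a < n ] ∑[ b < n ] ∑[ i < r ] ∑[ j < r ] F i j a b ∎
    where open ≡-Reasoning

  distinct-witnesses : ∀ {n} k (p : Fin n → Bool) → k ≤ ∑[ i < n ] 𝟙 (p i) →
    Σ (Fin k → Fin n) λ g → Injective _≡_ _≡_ g × (∀ a → p (g a) ≡ true)
  distinct-witnesses         zero    p _  = (λ ()) , (λ { {()} }) , (λ ())
  distinct-witnesses {zero}  (suc k) p ()
  distinct-witnesses {suc n} (suc k) p k<∑ with p zero in p₀
  ... | true with g , g-inj , pg ← distinct-witnesses k (p ∘ suc) (≤-pred k<∑) = g′ , g′-inj , pg′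
    where
    g′ : Fin (suc k) → Fin (suc n)
    g′ zero    = zero
    g′ (suc a) = suc (g a)
    g′-inj : Injective _≡_ _≡_ g′
    g′-inj {zero}  {zero}  _  = refl
    g′-inj {suc a} {suc b} eq = cong suc (g-inj (Fin.suc-injective eq))
    pg′ : ∀ a → p (g′ a) ≡ true
    pg′ zero    = p₀
    pg′ (suc a) = pg a
  ... | false with g , g-inj , pg ← distinct-witnesses (suc k) (p ∘ suc) k<∑ =
    suc ∘ g , g-inj ∘ Fin.suc-injective , pg

  witness : ∀ {n} (p : Fin n → Bool) → 1 ≤ ∑[ i < n ] 𝟙 (p i) → Σ (Fin n) λ x → p x ≡ true
  witness p 1≤∑ with g , _ , pg ← distinct-witnesses 1 p 1≤∑ = g zero , pg zero

  count-tabulate : ∀ {A : Set} {n} (p : A → Bool) (g : Fin n → A) →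
    count p (tabulate g) ≡ ∑[ i < n ] 𝟙 (p (g i))
  count-tabulate {n = zero}  p g = refl
  count-tabulate {n = suc n} p g with p (g zero)
  ... | true  = cong suc (count-tabulate p (g ∘ suc))
  ... | false = count-tabulate p (g ∘ suc)

  count-allFin : ∀ {n} (p : Fin n → Bool) → count p (allFin n) ≡ ∑[ i < n ] 𝟙 (p i)
  count-allFin p = count-tabulate p (λ i → i)

  count-++ : ∀ {A : Set} (p : A → Bool) (xs ys : List A) → count p (xs ++ ys) ≡ count p xs + count p ys
  count-++ p []       ys = refl
  count-++ p (x ∷ xs) ys with p x
  ... | true  = cong suc (count-++ p xs ys)
  ... | false = count-++ p xs ys

  count-concatMap : ∀ {A B : Set} {n} (p : B → Bool) (h : A → List B) (g : Fin n → A) →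
    count p (concatMap h (tabulate g)) ≡ ∑[ i < n ] count p (h (g i))
  count-concatMap {n = zero}  p h g = refl
  count-concatMap {n = suc n} p h g =
    trans (count-++ p (h (g zero)) _) (cong (count p (h (g zero)) +_) (count-concatMap p h (g ∘ suc)))

  count-if : ∀ {A : Set} (p : A → Bool) (b : Bool) (x : A) → count p (if b then x ∷ [] else []) ≡ 𝟙 (b ∧ p x)
  count-if p true  x with p x
  ... | true  = refl
  ... | false = refl
  count-if p false x = refl

  count-none : ∀ {A : Set} (p : A → Bool) (xs : List A) → (∀ x → p x ≡ false) → count p xs ≡ 0
  count-none p []       none = refl
  count-none p (x ∷ xs) none rewrite none x = count-none p xs none

  _<F_ : ∀ {n} → Fin n → Fin n → Bool
  a <F b = toℕ a <ᵇ toℕ b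

  count-vpairs : ∀ {n} (f : Fin n → Fin n → Bool) →
    count (λ { (u , v) → f u v }) (vpairs n) ≡ ∑[ a < n ] ∑[ b < n ] 𝟙 ((a <F b) ∧ f a b)
  count-vpairs {n} f =
    trans (count-concatMap {n = n} _ _ (λ i → i))
          (sum-cong-≗ {n} λ a → trans (count-concatMap {n = n} _ _ (λ i → i))
                                      (sum-cong-≗ {n} λ b → count-if _ (a <F b) (a , b)))

module EdgeCounting where

  open import Defs hiding (sym)
  open Counting
  open import Data.Bool using (Bool; true; false; _∧_; _∨_; not)
  open import Data.Bool.Properties using (T-≡; ∧-comm; ∨-comm)
  open import Data.Empty using (⊥; ⊥-elim)
  open import Data.Fin using (Fin; toℕ)
  open import Data.Fin.Properties using (toℕ-injective)
  open import Data.Nat using (ℕ; _+_; _*_; _<_; _<ᵇ_)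
  open import Relation.Binary.Definitions using (tri<; tri≈; tri>)
  open import Data.Nat.Properties hiding (_≟_)
  open import Data.Product using (_,_)
  open import Function using (_∘_; Equivalence)
  open import Relation.Binary.PropositionalEquality
  open import Relation.Nullary using (¬_)

  <⇒<ᵇ≡true : ∀ {m n} → m < n → (m <ᵇ n) ≡ true
  <⇒<ᵇ≡true = Equivalence.to T-≡ ∘ <⇒<ᵇ

  ≮⇒<ᵇ≡false : ∀ {m n} → ¬ m < n → (m <ᵇ n) ≡ false
  ≮⇒<ᵇ≡false {m} {n} m≮n with m <ᵇ n in eq
  ... | false = refl
  ... | true  = ⊥-elim (m≮n (<ᵇ⇒< m n (Equivalence.from T-≡ eq)))

  <F-irrefl : ∀ {n} (a : Fin n) → (a <F a) ≡ false
  <F-irrefl a = ≮⇒<ᵇ≡false {toℕ a} (<-irrefl refl)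

  𝟙-by-order : ∀ {n} (f : Fin n → Fin n → Bool) → (∀ a → f a a ≡ false) → ∀ a b →
    𝟙 (f a b) ≡ 𝟙 ((a <F b) ∧ f a b) + 𝟙 ((b <F a) ∧ f a b)
  𝟙-by-order f irr a b with <-cmp (toℕ a) (toℕ b)
  ... | tri< a<b _ b≮a rewrite <⇒<ᵇ≡true a<b | ≮⇒<ᵇ≡false b≮a = sym (+-identityʳ _)
  ... | tri> a≮b _ b<a rewrite ≮⇒<ᵇ≡false a≮b | <⇒<ᵇ≡true b<a = refl
  ... | tri≈ _ a≡b _ rewrite toℕ-injective a≡b | irr b | <F-irrefl b = refl

  𝟙-<F-or : ∀ {n} (a b : Fin n) → 𝟙 (a <F b) + 𝟙 (b <F a) ≡ 𝟙 (not (a == b))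
  𝟙-<F-or a b with <-cmp (toℕ a) (toℕ b)
  ... | tri< a<b _ b≮a rewrite <⇒<ᵇ≡true a<b | ≮⇒<ᵇ≡false b≮a
                             | ≢⇒==-false (<⇒≢ a<b ∘ cong toℕ) = refl
  ... | tri> a≮b _ b<a rewrite ≮⇒<ᵇ≡false a≮b | <⇒<ᵇ≡true b<a
                             | ≢⇒==-false (>⇒≢ b<a ∘ cong toℕ) = refl
  ... | tri≈ _ a≡b _ rewrite toℕ-injective a≡b | <F-irrefl b | ==-refl b = refl

  handshake : ∀ {n} (f : Fin n → Fin n → Bool) → (∀ a b → f a b ≡ f b a) → (∀ a → f a a ≡ false) →
    ∑[ a < n ] ∑[ b < n ] 𝟙 (f a b) ≡ 2 * count (λ { (u , v) → f u v }) (vpairs n)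
  handshake {n} f f-sym f-irr = begin
    ∑[ a < n ] ∑[ b < n ] 𝟙 (f a b)
      ≡⟨ sum-cong-≗ {n} (λ a → trans (sum-cong-≗ {n} (𝟙-by-order f f-irr a)) (∑-distrib-+ {n} _ _)) ⟩
    ∑[ a < n ] (∑[ b < n ] 𝟙 ((a <F b) ∧ f a b) + ∑[ b < n ] 𝟙 ((b <F a) ∧ f a b))
      ≡⟨ ∑-distrib-+ {n} _ _ ⟩
    below + ∑[ a < n ] ∑[ b < n ] 𝟙 ((b <F a) ∧ f a b)
      ≡⟨ cong (below +_) (∑-comm (λ a b → 𝟙 ((b <F a) ∧ f a b))) ⟩
    below + ∑[ b < n ] ∑[ a < n ] 𝟙 ((b <F a) ∧ f a b)
      ≡⟨ cong (below +_) (sum-cong-≗ {n} λ b → sum-cong-≗ {n} λ a → cong (λ x → 𝟙 ((b <F a) ∧ x)) (f-sym a b)) ⟩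
    below + below
      ≡⟨ cong (below +_) (sym (+-identityʳ below)) ⟩
    2 * below
      ≡⟨ cong (2 *_) (sym (count-vpairs f)) ⟩
    2 * count (λ { (u , v) → f u v }) (vpairs n) ∎
    where
    open ≡-Reasoning
    below = ∑[ a < n ] ∑[ b < n ] 𝟙 ((a <F b) ∧ f a b)

  module _ {n : ℕ} (G : Graph n) where

    private
      A = adj G

    eIn-ordered : ∀ (P : Fin n → Bool) → 2 * eIn G P ≡ ∑[ a < n ] ∑[ b < n ] 𝟙 (A a b ∧ P a ∧ P b)
    eIn-ordered P = sym (handshake _ symm irr)
      where
      symm : ∀ a b → (A a b ∧ P a ∧ P b) ≡ (A b a ∧ P b ∧ P a)
      symm a b = cong₂ _∧_ (Graph.sym G a b) (∧-comm (P a) (P b))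
      irr : ∀ a → (A a a ∧ P a ∧ P a) ≡ false
      irr a rewrite irrefl G a = refl

    eBetween-ordered : ∀ (P R : Fin n → Bool) →
      2 * eBetween G P R ≡ ∑[ a < n ] ∑[ b < n ] 𝟙 (A a b ∧ ((P a ∧ R b) ∨ (R a ∧ P b)))
    eBetween-ordered P R = sym (handshake _ symm irr)
      where
      symm : ∀ a b → (A a b ∧ ((P a ∧ R b) ∨ (R a ∧ P b))) ≡ (A b a ∧ ((P b ∧ R a) ∨ (R b ∧ P a)))
      symm a b = cong₂ _∧_ (Graph.sym G a b)
        (trans (∨-comm (P a ∧ R b) (R a ∧ P b)) (cong₂ _∨_ (∧-comm (R a) (P b)) (∧-comm (P a) (R b))))
      irr : ∀ a → (A a a ∧ ((P a ∧ R a) ∨ (R a ∧ P a))) ≡ false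
      irr a rewrite irrefl G a = refl

    edges-ordered : 2 * edges G ≡ ∑[ a < n ] ∑[ b < n ] 𝟙 (A a b)
    edges-ordered = trans (eIn-ordered (λ _ → true))
      (sum-cong-≗ {n} λ a → sum-cong-≗ {n} λ b → cong 𝟙 (∧-true (A a b)))
      where
      ∧-true : ∀ x → (x ∧ true ∧ true) ≡ x
      ∧-true true  = refl
      ∧-true false = refl

    deg≡∑ : ∀ v → deg G v ≡ ∑[ b < n ] 𝟙 (A v b)
    deg≡∑ v = count-allFin (A v)

  Independent : ∀ {n} → Graph n → (Fin n → Bool) → Set
  Independent G P = ∀ u v → adj G u v ≡ true → P u ≡ true → P v ≡ true → ⊥

  independent⇒eIn≡0 : ∀ {n} (G : Graph n) (P : Fin n → Bool) → Independent G P → eIn G P ≡ 0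
  independent⇒eIn≡0 {n} G P no-edge = count-none (λ { (u , v) → adj G u v ∧ P u ∧ P v }) (vpairs n) λ { (u , v) → no-edge-false u v }
    where
    no-edge-false : ∀ u v → (adj G u v ∧ P u ∧ P v) ≡ false
    no-edge-false u v with adj G u v in u~v | P u in Pu | P v in Pv
    ... | true  | true  | true  = ⊥-elim (no-edge u v u~v Pu Pv)
    ... | true  | true  | false = refl
    ... | true  | false | _     = refl
    ... | false | _     | _     = refl

module Partitions where

  open import Defs hiding (sym)
  open Counting
  open EdgeCounting
  open import Algebra.Bundles using (CommutativeMonoid)
  open import Data.Bool using (Bool; true; false; _∧_; _∨_; not; if_then_else_)
  open import Data.Bool.Properties using (∧-commutativeMonoid; ∧-distribˡ-∨)
  open import Data.Empty using (⊥)
  open import Data.Fin using (Fin)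
  open import Data.Nat using (ℕ; _+_; _*_; _≤_)
  open import Data.Nat.Properties hiding (_≟_)
  open import Data.Product using (_,_; proj₁)
  open import Relation.Binary.PropositionalEquality
  import Algebra.Properties.CommutativeSemigroup as CSProps

  private
    module ∧ = CSProps (CommutativeMonoid.commutativeSemigroup ∧-commutativeMonoid)

  cross-pair-counted-once : ∀ {r} (x : Bool) (X Y : Fin r) →
    ∑[ i < r ] ∑[ j < r ] (𝟙 (i <F j) * 𝟙 (x ∧ ((X == i ∧ Y == j) ∨ (X == j ∧ Y == i)))) ≡ 𝟙 (x ∧ not (X == Y))
  cross-pair-counted-once {r} false X Y =
    trans (sum-cong-≗ {r} λ i → trans (sum-cong-≗ {r} λ j → *-zeroʳ (𝟙 (i <F j))) (sum-replicate-zero r))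
          (sum-replicate-zero r)
  cross-pair-counted-once {r} true X Y = begin
    ∑[ i < r ] ∑[ j < r ] (𝟙 (i <F j) * 𝟙 ((X == i ∧ Y == j) ∨ (X == j ∧ Y == i)))
      ≡⟨ sum-cong-≗ {r} (λ i → trans (sum-cong-≗ {r} (split i)) (∑-distrib-+ {r} _ _)) ⟩
    ∑[ i < r ] (∑[ j < r ] (𝟙 (X == i) * 𝟙 (Y == j) * 𝟙 (i <F j)) + ∑[ j < r ] (𝟙 (Y == i) * 𝟙 (X == j) * 𝟙 (i <F j)))
      ≡⟨ ∑-distrib-+ {r} _ _ ⟩
    ∑[ i < r ] ∑[ j < r ] (𝟙 (X == i) * 𝟙 (Y == j) * 𝟙 (i <F j)) + ∑[ i < r ] ∑[ j < r ] (𝟙 (Y == i) * 𝟙 (X == j) * 𝟙 (i <F j))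
      ≡⟨ cong₂ _+_ (∑∑-pick X Y (λ i j → 𝟙 (i <F j))) (∑∑-pick Y X (λ i j → 𝟙 (i <F j))) ⟩
    𝟙 (X <F Y) + 𝟙 (Y <F X)
      ≡⟨ 𝟙-<F-or X Y ⟩
    𝟙 (not (X == Y)) ∎
    where
    open ≡-Reasoning
    𝟙-∧³ : ∀ l p q → 𝟙 (l ∧ (p ∧ q)) ≡ 𝟙 p * 𝟙 q * 𝟙 l
    𝟙-∧³ l p q = trans (𝟙-∧ l (p ∧ q)) (trans (cong (𝟙 l *_) (𝟙-∧ p q)) (*-comm (𝟙 l) _))
    disjoint : ∀ i j → (i <F j ∧ (X == i ∧ Y == j)) ≡ true → (i <F j ∧ (X == j ∧ Y == i)) ≡ true → ⊥
    disjoint i j h h′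
      with i<j , X=i,Y=j ← ∧-≡true {i <F j} {X == i ∧ Y == j} h
         | _ , X=j,Y=i ← ∧-≡true {i <F j} {X == j ∧ Y == i} h′
      with refl ← ==⇒≡ {x = X} {i} (proj₁ (∧-≡true {X == i} {Y == j} X=i,Y=j))
         | refl ← ==⇒≡ {x = X} {j} (proj₁ (∧-≡true {X == j} {Y == i} X=j,Y=i))
      with () ← trans (sym i<j) (<F-irrefl X)
    split : ∀ i j → 𝟙 (i <F j) * 𝟙 ((X == i ∧ Y == j) ∨ (X == j ∧ Y == i))
                  ≡ 𝟙 (X == i) * 𝟙 (Y == j) * 𝟙 (i <F j) + 𝟙 (Y == i) * 𝟙 (X == j) * 𝟙 (i <F j)
    split i j = begin
      𝟙 (i <F j) * 𝟙 ((X == i ∧ Y == j) ∨ (X == j ∧ Y == i))   ≡⟨ sym (𝟙-∧ (i <F j) _) ⟩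
      𝟙 (i <F j ∧ ((X == i ∧ Y == j) ∨ (X == j ∧ Y == i)))      ≡⟨ cong 𝟙 (∧-distribˡ-∨ (i <F j) _ _) ⟩
      𝟙 ((i <F j ∧ (X == i ∧ Y == j)) ∨ (i <F j ∧ (X == j ∧ Y == i))) ≡⟨ 𝟙-∨-disjoint _ _ (disjoint i j) ⟩
      𝟙 (i <F j ∧ (X == i ∧ Y == j)) + 𝟙 (i <F j ∧ (X == j ∧ Y == i))
        ≡⟨ cong₂ _+_ (𝟙-∧³ (i <F j) (X == i) (Y == j))
                     (trans (𝟙-∧³ (i <F j) (X == j) (Y == i)) (cong (_* 𝟙 (i <F j)) (*-comm (𝟙 (X == j)) _))) ⟩
      𝟙 (X == i) * 𝟙 (Y == j) * 𝟙 (i <F j) + 𝟙 (Y == i) * 𝟙 (X == j) * 𝟙 (i <F j) ∎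

  moveTo : ∀ {n r} → (Fin n → Fin r) → Fin n → Fin r → Fin n → Fin r
  moveTo c u j w = if w == u then j else c w

  module _ {n r : ℕ} (G : Graph n) (c : Fin n → Fin r) where

    private
      A = adj G

    inSum-ordered : 2 * inSum G c ≡ ∑[ a < n ] ∑[ b < n ] 𝟙 (A a b ∧ (c a == c b))
    inSum-ordered = begin
      2 * inSum G c
        ≡⟨ cong (2 *_) (sum-map-allFin (λ i → eIn G (part c i))) ⟩
      2 * ∑[ i < r ] eIn G (part c i)
        ≡⟨ *-distribˡ-sum {r} 2 _ ⟩
      ∑[ i < r ] (2 * eIn G (part c i))
        ≡⟨ sum-cong-≗ {r} (λ i → eIn-ordered G (part c i)) ⟩
      ∑[ i < r ] ∑[ a < n ] ∑[ b < n ] 𝟙 (A a b ∧ (c a == i) ∧ (c b == i))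
        ≡⟨ trans (∑-comm {r} {n} _) (sum-cong-≗ {n} λ a → ∑-comm {r} {n} _) ⟩
      ∑[ a < n ] ∑[ b < n ] ∑[ i < r ] 𝟙 (A a b ∧ (c a == i) ∧ (c b == i))
        ≡⟨ sum-cong-≗ {n} (λ a → sum-cong-≗ {n} λ b → same-part a b) ⟩
      ∑[ a < n ] ∑[ b < n ] 𝟙 (A a b ∧ (c a == c b)) ∎
      where
      open ≡-Reasoning
      same-part : ∀ a b → ∑[ i < r ] 𝟙 (A a b ∧ (c a == i) ∧ (c b == i)) ≡ 𝟙 (A a b ∧ (c a == c b))
      same-part a b = begin
        ∑[ i < r ] 𝟙 (A a b ∧ (c a == i) ∧ (c b == i))
          ≡⟨ sum-cong-≗ {r} (λ i → trans (cong 𝟙 (∧.x∙yz≈y∙xz (A a b) (c a == i) (c b == i))) (𝟙-∧ (c a == i) _)) ⟩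
        ∑[ i < r ] (𝟙 (c a == i) * 𝟙 (A a b ∧ (c b == i)))
          ≡⟨ ∑-pick (c a) (λ i → 𝟙 (A a b ∧ (c b == i))) ⟩
        𝟙 (A a b ∧ (c b == c a))
          ≡⟨ cong (λ x → 𝟙 (A a b ∧ x)) (==-sym (c b) (c a)) ⟩
        𝟙 (A a b ∧ (c a == c b)) ∎

    crossSum-ordered : 2 * crossSum G c ≡ ∑[ a < n ] ∑[ b < n ] 𝟙 (A a b ∧ not (c a == c b))
    crossSum-ordered = begin
      2 * crossSum G c
        ≡⟨ cong (2 *_) (trans (sum-map-allFin {r} _) (sum-cong-≗ {r} λ i → sum-map-allFin {r} _)) ⟩
      2 * ∑[ i < r ] ∑[ j < r ] (if i <F j then eBetween G (part c i) (part c j) else 0)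
        ≡⟨ trans (*-distribˡ-sum {r} 2 _) (sum-cong-≗ {r} λ i → *-distribˡ-sum {r} 2 _) ⟩
      ∑[ i < r ] ∑[ j < r ] (2 * (if i <F j then eBetween G (part c i) (part c j) else 0))
        ≡⟨ sum-cong-≗ {r} (λ i → sum-cong-≗ {r} λ j → ordered i j) ⟩
      ∑[ i < r ] ∑[ j < r ] (𝟙 (i <F j) * ∑[ a < n ] ∑[ b < n ] 𝟙 (A a b ∧ D a b i j))
        ≡⟨ sum-cong-≗ {r} (λ i → sum-cong-≗ {r} λ j → trans (*-distribˡ-sum {n} (𝟙 (i <F j)) _)
                                                            (sum-cong-≗ {n} λ a → *-distribˡ-sum {n} (𝟙 (i <F j)) _)) ⟩
      ∑[ i < r ] ∑[ j < r ] ∑[ a < n ] ∑[ b < n ] (𝟙 (i <F j) * 𝟙 (A a b ∧ D a b i j))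
        ≡⟨ ∑-comm⁴ {r} {n} _ ⟩
      ∑[ a < n ] ∑[ b < n ] ∑[ i < r ] ∑[ j < r ] (𝟙 (i <F j) * 𝟙 (A a b ∧ D a b i j))
        ≡⟨ sum-cong-≗ {n} (λ a → sum-cong-≗ {n} λ b → cross-pair-counted-once (A a b) (c a) (c b)) ⟩
      ∑[ a < n ] ∑[ b < n ] 𝟙 (A a b ∧ not (c a == c b)) ∎
      where
      open ≡-Reasoning
      D : Fin n → Fin n → Fin r → Fin r → Bool
      D a b i j = (c a == i ∧ c b == j) ∨ (c a == j ∧ c b == i)
      if-then-0 : ∀ l x → 2 * (if l then x else 0) ≡ 𝟙 l * (2 * x)
      if-then-0 true  x = sym (+-identityʳ (2 * x))
      if-then-0 false x = refl
      ordered : ∀ i j → 2 * (if i <F j then eBetween G (part c i) (part c j) else 0)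
                      ≡ 𝟙 (i <F j) * ∑[ a < n ] ∑[ b < n ] 𝟙 (A a b ∧ D a b i j)
      ordered i j = trans (if-then-0 (i <F j) _) (cong (𝟙 (i <F j) *_) (eBetween-ordered G (part c i) (part c j)))

  module _ {n r : ℕ} (G : Graph n) (c : Fin n → Fin r) where

    private
      A = adj G

    partDeg : Fin n → Fin r → ℕ
    partDeg u i = ∑[ b < n ] 𝟙 (A u b ∧ (c b == i))

    crossDeg : Fin n → ℕ
    crossDeg u = ∑[ b < n ] 𝟙 (A u b ∧ not (c u == c b))

    crossMiss : Fin n → ℕ
    crossMiss u = ∑[ b < n ] 𝟙 (not (c u == c b) ∧ not (A u b))

    deg-split : ∀ u → deg G u ≡ partDeg u (c u) + crossDeg u
    deg-split u = trans (deg≡∑ G u) (trans (sum-cong-≗ {n} split) (∑-distrib-+ {n} _ _))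
      where
      split : ∀ b → 𝟙 (A u b) ≡ 𝟙 (A u b ∧ (c b == c u)) + 𝟙 (A u b ∧ not (c u == c b))
      split b rewrite ==-sym (c b) (c u) = 𝟙-split (A u b) (c u == c b)

    card-split : ∀ u → card (part c (c u)) + crossDeg u + crossMiss u ≡ n
    card-split u = begin
      card (part c (c u)) + crossDeg u + crossMiss u
        ≡⟨ cong (λ x → x + crossDeg u + crossMiss u) (count-allFin (part c (c u))) ⟩
      ∑[ b < n ] 𝟙 (c b == c u) + crossDeg u + crossMiss u
        ≡⟨ cong (_+ crossMiss u) (sym (∑-distrib-+ {n} _ _)) ⟩
      ∑[ b < n ] (𝟙 (c b == c u) + 𝟙 (A u b ∧ not (c u == c b))) + crossMiss u
        ≡⟨ sym (∑-distrib-+ {n} _ _) ⟩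
      ∑[ b < n ] (𝟙 (c b == c u) + 𝟙 (A u b ∧ not (c u == c b)) + 𝟙 (not (c u == c b) ∧ not (A u b)))
        ≡⟨ sum-cong-≗ {n} (λ b → trans (cong (λ x → 𝟙 x + 𝟙 (A u b ∧ not (c u == c b)) + 𝟙 (not (c u == c b) ∧ not (A u b)))
                                               (==-sym (c b) (c u)))
                                         (one (A u b) (c u == c b))) ⟩
      ∑[ b < n ] 1
        ≡⟨ trans (∑-const n 1) (*-identityʳ n) ⟩
      n ∎
      where
      open ≡-Reasoning
      one : ∀ x p → 𝟙 p + 𝟙 (x ∧ not p) + 𝟙 (not p ∧ not x) ≡ 1
      one true  true  = refl
      one true  false = refl
      one false true  = refl
      one false false = refl

    crossMiss-cross : ∑[ w < n ] crossMiss w + 2 * crossSum G c ≡ ∑[ a < n ] ∑[ b < n ] 𝟙 (not (c a == c b))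
    crossMiss-cross = begin
      ∑[ w < n ] crossMiss w + 2 * crossSum G c
        ≡⟨ cong (∑[ w < n ] crossMiss w +_) (crossSum-ordered G c) ⟩
      ∑[ w < n ] crossMiss w + ∑[ a < n ] ∑[ b < n ] 𝟙 (A a b ∧ not (c a == c b))
        ≡⟨ sym (∑∑-distrib-+ {n} _ _) ⟩
      ∑[ a < n ] ∑[ b < n ] (𝟙 (not (c a == c b) ∧ not (A a b)) + 𝟙 (A a b ∧ not (c a == c b)))
        ≡⟨ sum-cong-≗ {n} (λ a → sum-cong-≗ {n} λ b → across (A a b) (c a == c b)) ⟩
      ∑[ a < n ] ∑[ b < n ] 𝟙 (not (c a == c b)) ∎
      where
      open ≡-Reasoning
      across : ∀ x p → 𝟙 (not p ∧ not x) + 𝟙 (x ∧ not p) ≡ 𝟙 (not p)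
      across true  true  = refl
      across true  false = refl
      across false true  = refl
      across false false = refl

    edges-split : 2 * edges G ≡ 2 * inSum G c + 2 * crossSum G c
    edges-split = begin
      2 * edges G                                          ≡⟨ edges-ordered G ⟩
      ∑[ a < n ] ∑[ b < n ] 𝟙 (A a b)
        ≡⟨ trans (sum-cong-≗ {n} λ a → sum-cong-≗ {n} λ b → 𝟙-split (A a b) (c a == c b)) (∑∑-distrib-+ {n} _ _) ⟩
      ∑[ a < n ] ∑[ b < n ] 𝟙 (A a b ∧ (c a == c b)) + ∑[ a < n ] ∑[ b < n ] 𝟙 (A a b ∧ not (c a == c b))
        ≡⟨ sym (cong₂ _+_ (inSum-ordered G c) (crossSum-ordered G c)) ⟩
      2 * inSum G c + 2 * crossSum G c                     ∎
      where open ≡-Reasoning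

    crossMiss-∑-≤ : ∀ (H : Graph n) (extra : Fin n → Fin n → ℕ) → edges H ≤ edges G →
      (∀ a b → 𝟙 (not (c a == c b)) ≤ 𝟙 (adj H a b) + extra a b) →
      ∑[ w < n ] crossMiss w ≤ 2 * inSum G c + ∑[ a < n ] ∑[ b < n ] extra a b
    crossMiss-∑-≤ H extra H≤G covered = +-cancelʳ-≤ (2 * crossSum G c) _ _ (begin
      ∑[ w < n ] crossMiss w + 2 * crossSum G c               ≡⟨ crossMiss-cross ⟩
      ∑[ a < n ] ∑[ b < n ] 𝟙 (not (c a == c b))            ≤⟨ ∑-mono-≤ (λ a → ∑-mono-≤ (covered a)) ⟩
      ∑[ a < n ] ∑[ b < n ] (𝟙 (adj H a b) + extra a b)     ≡⟨ ∑∑-distrib-+ {n} _ _ ⟩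
      ∑[ a < n ] ∑[ b < n ] 𝟙 (adj H a b) + E               ≡⟨ cong (_+ E) (sym (edges-ordered H)) ⟩
      2 * edges H + E                                        ≤⟨ +-monoˡ-≤ E (*-monoʳ-≤ 2 H≤G) ⟩
      2 * edges G + E                                        ≡⟨ cong (_+ E) edges-split ⟩
      2 * inSum G c + 2 * crossSum G c + E                   ≡⟨ +-assoc (2 * inSum G c) _ E ⟩
      2 * inSum G c + (2 * crossSum G c + E)                 ≡⟨ cong (2 * inSum G c +_) (+-comm _ E) ⟩
      2 * inSum G c + (E + 2 * crossSum G c)                 ≡⟨ sym (+-assoc (2 * inSum G c) E _) ⟩
      2 * inSum G c + E + 2 * crossSum G c                   ∎)
      where
      open ≤-Reasoning
      E = ∑[ a < n ] ∑[ b < n ] extra a b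

    pivot : Fin n → Fin r → Fin n → Fin n → ℕ
    pivot u i a b = 𝟙 (a == u) * 𝟙 (A a b ∧ (c b == i)) + 𝟙 (b == u) * 𝟙 (A a b ∧ (c a == i))

    ∑∑-pivot : ∀ u i → ∑[ a < n ] ∑[ b < n ] pivot u i a b ≡ 2 * partDeg u i
    ∑∑-pivot u i = begin
      ∑[ a < n ] ∑[ b < n ] pivot u i a b
        ≡⟨ ∑∑-distrib-+ {n} _ _ ⟩
      ∑[ a < n ] ∑[ b < n ] (𝟙 (a == u) * 𝟙 (A a b ∧ (c b == i)))
        + ∑[ a < n ] ∑[ b < n ] (𝟙 (b == u) * 𝟙 (A a b ∧ (c a == i)))
        ≡⟨ cong₂ _+_ (trans (sum-cong-≗ {n} λ a → sym (*-distribˡ-sum {n} (𝟙 (a == u)) _)) (∑-pickʳ u _))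
                     (sum-cong-≗ {n} λ a → trans (∑-pickʳ u _) (cong (λ x → 𝟙 (x ∧ (c a == i))) (Graph.sym G a u))) ⟩
      partDeg u i + partDeg u i
        ≡⟨ cong (partDeg u i +_) (sym (+-identityʳ _)) ⟩
      2 * partDeg u i ∎
      where open ≡-Reasoning

    -- Moving u only changes the status of the pairs through u, which the pivot terms account for.
    moveTo-pointwise : ∀ u j a b → 𝟙 (A a b ∧ not (c a == c b)) + pivot u (c u) a b
                                 ≡ 𝟙 (A a b ∧ not (moveTo c u j a == moveTo c u j b)) + pivot u j a b
    moveTo-pointwise u j a b with a == u in a=u | b == u in b=u
    ... | true  | true  with refl ← ==⇒≡ {x = a} a=u | refl ← ==⇒≡ {x = b} b=u rewrite irrefl G a = refl
    ... | true  | false with refl ← ==⇒≡ {x = a} a=u =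
      trans (trans (cong (λ z → 𝟙 (A a b ∧ not (c a == c b)) + (1 * 𝟙 (A a b ∧ z) + 0)) (==-sym (c b) (c a)))
                   (whole (A a b) (c a == c b)))
            (sym (trans (cong (λ z → 𝟙 (A a b ∧ not (j == c b)) + (1 * 𝟙 (A a b ∧ z) + 0)) (==-sym (c b) j))
                        (whole (A a b) (j == c b))))
      where
      whole : ∀ x p → 𝟙 (x ∧ not p) + (1 * 𝟙 (x ∧ p) + 0) ≡ 𝟙 x
      whole true  true  = refl
      whole true  false = refl
      whole false p     = refl
    ... | false | true  with refl ← ==⇒≡ {x = b} b=u =
      trans (whole′ (A a b) (c a == c b)) (sym (whole′ (A a b) (c a == j)))
      where
      whole′ : ∀ x p → 𝟙 (x ∧ not p) + (0 + 1 * 𝟙 (x ∧ p)) ≡ 𝟙 x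
      whole′ true  true  = refl
      whole′ true  false = refl
      whole′ false p     = refl
    ... | false | false = refl

    moveTo-balance : ∀ u j → 2 * crossSum G c + 2 * partDeg u (c u) ≡ 2 * crossSum G (moveTo c u j) + 2 * partDeg u j
    moveTo-balance u j = begin
      2 * crossSum G c + 2 * partDeg u (c u)
        ≡⟨ cong₂ _+_ (crossSum-ordered G c) (sym (∑∑-pivot u (c u))) ⟩
      ∑[ a < n ] ∑[ b < n ] 𝟙 (A a b ∧ not (c a == c b)) + ∑[ a < n ] ∑[ b < n ] pivot u (c u) a b
        ≡⟨ sym (∑∑-distrib-+ {n} _ _) ⟩
      ∑[ a < n ] ∑[ b < n ] (𝟙 (A a b ∧ not (c a == c b)) + pivot u (c u) a b)
        ≡⟨ sum-cong-≗ {n} (λ a → sum-cong-≗ {n} (moveTo-pointwise u j a)) ⟩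
      ∑[ a < n ] ∑[ b < n ] (𝟙 (A a b ∧ not (c′ a == c′ b)) + pivot u j a b)
        ≡⟨ ∑∑-distrib-+ {n} _ _ ⟩
      ∑[ a < n ] ∑[ b < n ] 𝟙 (A a b ∧ not (c′ a == c′ b)) + ∑[ a < n ] ∑[ b < n ] pivot u j a b
        ≡⟨ cong₂ _+_ (sym (crossSum-ordered G c′)) (∑∑-pivot u j) ⟩
      2 * crossSum G c′ + 2 * partDeg u j ∎
      where
      open ≡-Reasoning
      c′ = moveTo c u j

    ownDeg≤partDeg : ∀ u j → crossSum G (moveTo c u j) ≤ crossSum G c → partDeg u (c u) ≤ partDeg u j
    ownDeg≤partDeg u j moved≤ = *-cancelˡ-≤ 2 (+-cancelˡ-≤ (2 * crossSum G c) _ _ (begin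
      2 * crossSum G c + 2 * partDeg u (c u)               ≡⟨ moveTo-balance u j ⟩
      2 * crossSum G (moveTo c u j) + 2 * partDeg u j      ≤⟨ +-monoˡ-≤ _ (*-monoʳ-≤ 2 moved≤) ⟩
      2 * crossSum G c + 2 * partDeg u j                   ∎))
      where open ≤-Reasoning

module Books where

  open import Defs hiding (sym)
  open EdgeCounting using (<⇒<ᵇ≡true; ≮⇒<ᵇ≡false)
  open import Data.Bool using (true; false)
  open import Data.Bool.Properties using (T-≡; ∨-zeroʳ; ∧-zeroʳ)
  open import Data.Fin using (Fin; toℕ; _↑ˡ_; _↑ʳ_; splitAt; inject≤)
  open import Data.Fin.Properties
    using (toℕ-injective; toℕ-↑ʳ; toℕ-inject≤; toℕ<n; splitAt-↑ˡ; splitAt-↑ʳ; splitAt⁻¹-↑ˡ; splitAt⁻¹-↑ʳ; _≟_)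
  open import Data.Nat using (ℕ; suc; _+_; _≤_; _≡ᵇ_)
  open import Data.Nat.Properties using (≡ᵇ⇒≡; ≡⇒≡ᵇ; m≤n⇒m<n∨m≡n; ≤∧≢⇒<; ≤-pred; +-comm; +-monoʳ-≤; m+n≮m)
  open import Data.Product using (Σ; _,_)
  open import Data.Sum using (inj₁; inj₂)
  open import Function using (_∘_; Equivalence)
  open import Function.Definitions using (Injective)
  open import Relation.Binary.PropositionalEquality
  open import Relation.Nullary using (yes; no; contradiction)

  IsClique : ∀ {n a} → Graph n → (Fin a → Fin n) → Set
  IsClique G κ = ∀ i j → i ≢ j → adj G (κ i) (κ j) ≡ true

  ≢⇒≡ᵇ≡false : ∀ {m n} → m ≢ n → (m ≡ᵇ n) ≡ false
  ≢⇒≡ᵇ≡false {m} {n} m≢n with m ≡ᵇ n in eq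
  ... | false = refl
  ... | true  = contradiction (≡ᵇ⇒≡ m n (Equivalence.from T-≡ eq)) m≢n

  Badj-below : ∀ r k (a b : Fin (r + k)) → toℕ a ≢ toℕ b → toℕ a ≤ r → toℕ b ≤ r → Badj r k a b ≡ true
  Badj-below r k a b a≢b a≤r b≤r rewrite ≢⇒≡ᵇ≡false a≢b with m≤n⇒m<n∨m≡n a≤r
  ... | inj₁ a<r rewrite <⇒<ᵇ≡true a<r = refl
  ... | inj₂ a≡r rewrite <⇒<ᵇ≡true (≤∧≢⇒< b≤r (λ b≡r → a≢b (trans a≡r (sym b≡r)))) = ∨-zeroʳ _

  Badj-irrefl : ∀ r k (a : Fin (r + k)) → Badj r k a a ≡ false
  Badj-irrefl r k a rewrite Equivalence.to T-≡ (≡⇒≡ᵇ (toℕ a) (toℕ a) refl) = refl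

  Badj-above : ∀ r k (i j : Fin k) → Badj r k (r ↑ʳ i) (r ↑ʳ j) ≡ false
  Badj-above r k i j rewrite toℕ-↑ʳ r i | toℕ-↑ʳ r j
                           | ≮⇒<ᵇ≡false (m+n≮m r (toℕ i)) | ≮⇒<ᵇ≡false (m+n≮m r (toℕ j))
    = ∧-zeroʳ _

  book-contains-clique : ∀ {n} (G : Graph n) r k → 1 ≤ k → Contains (r + k) (Badj r k) G →
    Σ (Fin (suc r) → Fin n) (IsClique G)
  book-contains-clique G r k k≥1 (f , _ , f-adj) = f ∘ ι , clique
    where
    suc-r≤r+k : suc r ≤ r + k
    suc-r≤r+k = subst (_≤ r + k) (+-comm r 1) (+-monoʳ-≤ r k≥1)
    ι : Fin (suc r) → Fin (r + k)
    ι i = inject≤ i suc-r≤r+k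
    clique : IsClique G (f ∘ ι)
    clique i j i≢j = f-adj (ι i) (ι j) (Badj-below r k (ι i) (ι j)
      (λ eq → i≢j (toℕ-injective (trans (sym (toℕ-inject≤ i _)) (trans eq (toℕ-inject≤ j _)))))
      (subst (_≤ r) (sym (toℕ-inject≤ i _)) (≤-pred (toℕ<n i)))
      (subst (_≤ r) (sym (toℕ-inject≤ j _)) (≤-pred (toℕ<n j))))

  data BookPart (r k : ℕ) : Fin (r + k) → Set where
    spine : (i : Fin r) → BookPart r k (i ↑ˡ k)
    page  : (j : Fin k) → BookPart r k (r ↑ʳ j)

  bookPart : ∀ r k (a : Fin (r + k)) → BookPart r k a
  bookPart r k a with splitAt r a in eq
  ... | inj₁ i rewrite sym (splitAt⁻¹-↑ˡ eq) = spine i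
  ... | inj₂ j rewrite sym (splitAt⁻¹-↑ʳ eq) = page j

  book-from-clique : ∀ {n r k} (G : Graph n) (κ : Fin r → Fin n) (g : Fin k → Fin n) →
    IsClique G κ → Injective _≡_ _≡_ g → (∀ i j → adj G (κ i) (g j) ≡ true) →
    Contains (r + k) (Badj r k) G
  book-from-clique {n} {r} {k} G κ g κ-clique g-inj κ-g = f , f-inj , f-adj
    where
    f : Fin (r + k) → Fin n
    f a with splitAt r a
    ... | inj₁ i = κ i
    ... | inj₂ j = g j

    f-spine : ∀ i → f (i ↑ˡ k) ≡ κ i
    f-spine i rewrite splitAt-↑ˡ r i k = refl

    f-page : ∀ j → f (r ↑ʳ j) ≡ g j
    f-page j rewrite splitAt-↑ʳ r k j = refl

    adj⇒≢ : ∀ x y → adj G x y ≡ true → x ≢ y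
    adj⇒≢ x y xy refl with () ← trans (sym xy) (irrefl G x)

    κ-inj : ∀ i j → κ i ≡ κ j → i ≡ j
    κ-inj i j eq with i ≟ j
    ... | yes i≡j = i≡j
    ... | no  i≢j = contradiction eq (adj⇒≢ _ _ (κ-clique i j i≢j))

    f-inj : Injective _≡_ _≡_ f
    f-inj {a} {b} eq with bookPart r k a | bookPart r k b
    ... | spine i | spine j = cong (_↑ˡ k) (κ-inj i j (trans (sym (f-spine i)) (trans eq (f-spine j))))
    ... | page i  | page j  = cong (r ↑ʳ_) (g-inj (trans (sym (f-page i)) (trans eq (f-page j))))
    ... | spine i | page j  = contradiction (trans (sym (f-spine i)) (trans eq (f-page j))) (adj⇒≢ _ _ (κ-g i j))
    ... | page i  | spine j = contradiction (trans (sym (f-spine j)) (trans (sym eq) (f-page i))) (adj⇒≢ _ _ (κ-g j i))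

    f-adj : ∀ a b → Badj r k a b ≡ true → adj G (f a) (f b) ≡ true
    f-adj a b ab with bookPart r k a | bookPart r k b
    ... | spine i | spine j rewrite f-spine i | f-spine j =
      κ-clique i j λ { refl → contradiction (trans (sym ab) (Badj-irrefl r k (i ↑ˡ k))) λ () }
    ... | spine i | page j  rewrite f-spine i | f-page j = κ-g i j
    ... | page i  | spine j rewrite f-page i | f-spine j = trans (Graph.sym G (g i) (κ j)) (κ-g j i)
    ... | page i  | page j  with () ← trans (sym ab) (Badj-above r k i j)

module TypeGraph where

  open import Defs hiding (sym)
  open Counting using (==-refl; ==-sym; ==⇒≡; ==-false⇒≢; ≢⇒==-false; not≡true⇒≡false; not≡false⇒≡true)
  open Books using (book-contains-clique)
  open import Data.Bool using (Bool; true; false; _∨_; not)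
  import Data.Bool.Properties as Bool
  open import Data.Empty using (⊥)
  open import Data.Fin using (Fin; suc; _↑ˡ_)
  open import Data.Fin.Patterns
  open import Data.Fin.Properties using (_≟_; all?; any?; pigeonhole; <⇒≢; ↑ˡ-injective; suc-injective)
  open import Data.Nat using (ℕ; suc; _+_; _≤_)
  open import Data.Nat.Properties using (≤-refl)
  open import Data.Product using (Σ; _×_; _,_)
  open import Data.Sum using (_⊎_; inj₁; inj₂)
  import Data.Sum as Sum
  open import Function using (_∘_)
  open import Relation.Binary.PropositionalEquality
  open import Relation.Nullary using (¬_; Dec; yes; no; contradiction)
  open import Relation.Nullary.Decidable using (from-yes; ¬?; _→-dec_; _⊎-dec_)

  rainbow-bound : ∀ {m} (h : Fin (suc m) → Fin m) → (∀ i j → i ≢ j → h i ≢ h j) → ⊥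
  rainbow-bound h distinct with pigeonhole ≤-refl h
  ... | i , j , i<j , hi≡hj = distinct i j (<⇒≢ i<j) hi≡hj

  next : Fin 5 → Fin 5
  next 0F = 1F
  next 1F = 2F
  next 2F = 3F
  next 3F = 4F
  next 4F = 0F

  C₅ : Fin 5 → Fin 5 → Bool
  C₅ a b = (next a == b) ∨ (next b == a)

  C₅-irrefl : ∀ a → C₅ a a ≡ false
  C₅-irrefl 0F = refl
  C₅-irrefl 1F = refl
  C₅-irrefl 2F = refl
  C₅-irrefl 3F = refl
  C₅-irrefl 4F = refl

  -- A clique of C₅ either avoids 0, and then lies on the path 1-2-3-4, or lies on the path 4-0-1;
  -- both paths are bipartite, with the sides given below.
  side₁₂₃₄ : Fin 5 → Fin 2
  side₁₂₃₄ 0F = 0F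
  side₁₂₃₄ 1F = 0F
  side₁₂₃₄ 2F = 1F
  side₁₂₃₄ 3F = 0F
  side₁₂₃₄ 4F = 1F

  side₄₀₁ : Fin 5 → Fin 2
  side₄₀₁ 0F      = 0F
  side₄₀₁ (suc _) = 1F

  side₁₂₃₄-proper : ∀ a b → a ≢ 0F → b ≢ 0F → C₅ a b ≡ true → side₁₂₃₄ a ≢ side₁₂₃₄ b
  side₁₂₃₄-proper = from-yes (all? λ a → all? λ b →
    ¬? (a ≟ 0F) →-dec ¬? (b ≟ 0F) →-dec (C₅ a b Bool.≟ true) →-dec ¬? (side₁₂₃₄ a ≟ side₁₂₃₄ b))

  side₄₀₁-proper : ∀ a b → (a ≡ 0F ⊎ C₅ 0F a ≡ true) → (b ≡ 0F ⊎ C₅ 0F b ≡ true) → C₅ a b ≡ true →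
    side₄₀₁ a ≢ side₄₀₁ b
  side₄₀₁-proper = from-yes (all? λ a → all? λ b →
    (a ≟ 0F ⊎-dec C₅ 0F a Bool.≟ true) →-dec (b ≟ 0F ⊎-dec C₅ 0F b Bool.≟ true) →-dec
    (C₅ a b Bool.≟ true) →-dec ¬? (side₄₀₁ a ≟ side₄₀₁ b))

  C₅-three-colours : ∀ {m} (σ : Fin 5 → Fin m) → (∀ a b → C₅ a b ≡ true → σ a ≢ σ b) →
    Σ (Fin 5 × Fin 5 × Fin 5) λ { (x , y , z) → σ x ≢ σ y × σ x ≢ σ z × σ y ≢ σ z }
  C₅-three-colours σ proper with σ 0F ≟ σ 2F
  ... | no σ₀≢σ₂ = (0F , 1F , 2F) , proper 0F 1F refl , σ₀≢σ₂ , proper 1F 2F refl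
  ... | yes σ₀≡σ₂ with σ 2F ≟ σ 4F
  ...   | no σ₂≢σ₄ = (2F , 3F , 4F) , proper 2F 3F refl , σ₂≢σ₄ , proper 3F 4F refl
  ...   | yes σ₂≡σ₄ = contradiction (sym (trans σ₀≡σ₂ σ₂≡σ₄)) (proper 4F 0F refl)

  -- The graph C₅ ∨ K_{r′}: its chromatic number is r′ + 3 while its clique number is r′ + 2.
  data Ty (r′ : ℕ) : Set where
    cyc : Fin 5 → Ty r′
    tp  : Fin r′ → Ty r′

  pattern t1 = cyc 0F
  pattern t2 = cyc 1F
  pattern t3 = cyc 2F
  pattern t4 = cyc 3F
  pattern t5 = cyc 4F

  tyAdj : ∀ {r′} → Ty r′ → Ty r′ → Bool
  tyAdj (cyc a) (cyc b) = C₅ a b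
  tyAdj (tp i)  (tp j)  = not (i == j)
  tyAdj _       _       = true

  tyAdj-sym : ∀ {r′} (s t : Ty r′) → tyAdj s t ≡ tyAdj t s
  tyAdj-sym (cyc a) (cyc b) = Bool.∨-comm (next a == b) (next b == a)
  tyAdj-sym (cyc a) (tp j)  = refl
  tyAdj-sym (tp i)  (cyc b) = refl
  tyAdj-sym (tp i)  (tp j)  = cong not (==-sym i j)

  tyAdj-irrefl : ∀ {r′} (s : Ty r′) → tyAdj s s ≡ false
  tyAdj-irrefl (cyc a) = C₅-irrefl a
  tyAdj-irrefl (tp i)  = cong not (==-refl i)

  Ty-not-colourable : ∀ {r′} (σ : Ty r′ → Fin (2 + r′)) → (∀ s t → tyAdj s t ≡ true → σ s ≢ σ t) → ⊥
  Ty-not-colourable {r′} σ proper with C₅-three-colours (σ ∘ cyc) (λ a b → proper (cyc a) (cyc b))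
  ... | (x , y , z) , x≢y , x≢z , y≢z = rainbow-bound (σ ∘ h) distinct
    where
    h : Fin (3 + r′) → Ty r′
    h 0F                  = cyc x
    h 1F                  = cyc y
    h 2F                  = cyc z
    h (suc (suc (suc j))) = tp j
    cyc-tp : ∀ a j → σ (cyc a) ≢ σ (tp j)
    cyc-tp a j = proper (cyc a) (tp j) refl
    distinct : ∀ i j → i ≢ j → σ (h i) ≢ σ (h j)
    distinct 0F 0F i≢j = contradiction refl i≢j
    distinct 1F 1F i≢j = contradiction refl i≢j
    distinct 2F 2F i≢j = contradiction refl i≢j
    distinct 0F 1F _ = x≢y
    distinct 0F 2F _ = x≢z
    distinct 1F 2F _ = y≢z
    distinct 1F 0F _ = x≢y ∘ sym
    distinct 2F 0F _ = x≢z ∘ sym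
    distinct 2F 1F _ = y≢z ∘ sym
    distinct 0F (suc (suc (suc j))) _ = cyc-tp x j
    distinct 1F (suc (suc (suc j))) _ = cyc-tp y j
    distinct 2F (suc (suc (suc j))) _ = cyc-tp z j
    distinct (suc (suc (suc i))) 0F _ = cyc-tp x i ∘ sym
    distinct (suc (suc (suc i))) 1F _ = cyc-tp y i ∘ sym
    distinct (suc (suc (suc i))) 2F _ = cyc-tp z i ∘ sym
    distinct (suc (suc (suc i))) (suc (suc (suc j))) i≢j =
      proper (tp i) (tp j) (cong not (≢⇒==-false {x = i} {j} (i≢j ∘ cong (λ l → suc (suc (suc l))))))

  slot : ∀ {r′} → (Fin 5 → Fin 2) → Ty r′ → Fin (2 + r′)
  slot {r′} side (cyc a) = side a ↑ˡ r′
  slot      side (tp j)  = suc (suc j)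

  cyc≢tp-slot : ∀ {r′} (x : Fin 2) (j : Fin r′) → x ↑ˡ r′ ≢ suc (suc j)
  cyc≢tp-slot 0F j ()
  cyc≢tp-slot 1F j ()

  slot-proper : ∀ {r′} (side : Fin 5 → Fin 2) (s t : Ty r′) → tyAdj s t ≡ true →
    (∀ a b → s ≡ cyc a → t ≡ cyc b → C₅ a b ≡ true → side a ≢ side b) → slot side s ≢ slot side t
  slot-proper {r′} side (cyc a) (cyc b) s~t sides = sides a b refl refl s~t ∘ ↑ˡ-injective r′ (side a) (side b)
  slot-proper side (cyc a) (tp j)  _ _ = cyc≢tp-slot (side a) j
  slot-proper side (tp i)  (cyc b) _ _ = cyc≢tp-slot (side b) i ∘ sym
  slot-proper side (tp i)  (tp j)  s~t _ =
    ==-false⇒≢ (not≡true⇒≡false s~t) ∘ suc-injective ∘ suc-injective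

  cyc-injective : ∀ {r′} {a b : Fin 5} → cyc {r′} a ≡ cyc b → a ≡ b
  cyc-injective refl = refl

  is-t1? : ∀ {r′} (s : Ty r′) → Dec (s ≡ t1)
  is-t1? t1            = yes refl
  is-t1? (cyc (suc _)) = no λ ()
  is-t1? (tp _)        = no λ ()

  Ty-clique-free : ∀ {r′} (g : Fin (3 + r′) → Ty r′) → (∀ i j → i ≢ j → tyAdj (g i) (g j) ≡ true) → ⊥
  Ty-clique-free g clique with any? (is-t1? ∘ g)
  ... | no no-t1 = rainbow-bound (slot side₁₂₃₄ ∘ g) λ i j i≢j →
    slot-proper side₁₂₃₄ (g i) (g j) (clique i j i≢j) λ a b gi≡a gj≡b →
      side₁₂₃₄-proper a b (λ { refl → no-t1 (i , gi≡a) }) (λ { refl → no-t1 (j , gj≡b) })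
  ... | yes (i₀ , gi₀≡t1) = rainbow-bound (slot side₄₀₁ ∘ g) λ i j i≢j →
    slot-proper side₄₀₁ (g i) (g j) (clique i j i≢j) λ a b gi≡a gj≡b →
      side₄₀₁-proper a b (near i a gi≡a) (near j b gj≡b)
    where
    near : ∀ i a → g i ≡ cyc a → a ≡ 0F ⊎ C₅ 0F a ≡ true
    near i a gi≡a with i ≟ i₀
    ... | yes refl = inj₁ (cyc-injective (trans (sym gi≡a) gi₀≡t1))
    ... | no i≢i₀  = inj₂ (subst₂ (λ s t → tyAdj s t ≡ true) gi₀≡t1 gi≡a (clique i₀ i (i≢i₀ ∘ sym)))

  blowUp : ∀ {n r′} → (Fin n → Ty r′) → Graph n
  blowUp τ = record
    { adj    = λ a b → tyAdj (τ a) (τ b)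
    ; sym    = λ a b → tyAdj-sym (τ a) (τ b)
    ; irrefl = tyAdj-irrefl ∘ τ
    }

  blowUp-not-partite : ∀ {n r′} (τ : Fin n → Ty r′) (s : Ty r′ → Fin n) → (∀ t → τ (s t) ≡ t) →
    ¬ RPartite (2 + r′) (blowUp τ)
  blowUp-not-partite τ s section (col , proper) = Ty-not-colourable (col ∘ s) λ x y x~y →
    proper (s x) (s y) (subst₂ (λ p q → tyAdj p q ≡ true) (sym (section x)) (sym (section y)) x~y)

  blowUp-BFree : ∀ {n r′} k → 1 ≤ k → (τ : Fin n → Ty r′) → BFree (2 + r′) k (blowUp τ)
  blowUp-BFree {r′ = r′} k k≥1 τ book with book-contains-clique (blowUp τ) (2 + r′) k k≥1 book
  ... | g , clique = Ty-clique-free (τ ∘ g) clique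

  -- In the comparison graph, types t1, t3, t4 lie in the part V₀, types t2, t5 in V₁ and tp j in V_{j+2}.
  partSide : Fin 5 → Fin 2
  partSide 0F = 0F
  partSide 1F = 1F
  partSide 2F = 0F
  partSide 3F = 0F
  partSide 4F = 1F

  partOf : ∀ {r′} → Ty r′ → Fin (2 + r′)
  partOf = slot partSide

  IsExtra : ∀ {r′} → Ty r′ → Set
  IsExtra s = s ≡ t4 ⊎ s ≡ t5

  C₅-missing-cross-pairs : ∀ a b → partSide a ≢ partSide b → C₅ a b ≡ false →
    (a ≡ 3F ⊎ a ≡ 4F) ⊎ (b ≡ 3F ⊎ b ≡ 4F)
  C₅-missing-cross-pairs = from-yes (all? λ a → all? λ b →
    ¬? (partSide a ≟ partSide b) →-dec (C₅ a b Bool.≟ false) →-dec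
    ((a ≟ 3F ⊎-dec a ≟ 4F) ⊎-dec (b ≟ 3F ⊎-dec b ≟ 4F)))

  missing-cross-pairs : ∀ {r′} (s t : Ty r′) → partOf s ≢ partOf t → tyAdj s t ≡ false →
    IsExtra s ⊎ IsExtra t
  missing-cross-pairs {r′} (cyc a) (cyc b) parts a≁b =
    Sum.map (Sum.map (cong cyc) (cong cyc)) (Sum.map (cong cyc) (cong cyc))
            (C₅-missing-cross-pairs a b (parts ∘ cong (_↑ˡ r′)) a≁b)
  missing-cross-pairs (cyc a) (tp j)  _ ()
  missing-cross-pairs (tp i)  (cyc b) _ ()
  missing-cross-pairs (tp i)  (tp j)  parts i≁j =
    contradiction (cong (λ l → suc (suc l)) (==⇒≡ {x = i} {j} (not≡false⇒≡true i≁j))) parts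

  sideIndex : Fin 5 → Fin 3
  sideIndex 0F = 0F
  sideIndex 1F = 0F
  sideIndex 2F = 1F
  sideIndex 3F = 2F
  sideIndex 4F = 1F

  side-position-injective : ∀ a b → partSide a ≡ partSide b → sideIndex a ≡ sideIndex b → a ≡ b
  side-position-injective = from-yes (all? λ a → all? λ b →
    (partSide a ≟ partSide b) →-dec (sideIndex a ≟ sideIndex b) →-dec (a ≟ b))

module RationalBounds where

  open import Defs hiding (sym)
  open import Data.Bool using (false; _∧_)
  open import Data.Integer as ℤ using (+_)
  import Data.Integer.Properties as ℤ
  open import Data.Nat as ℕ using (ℕ; zero; suc)
  import Data.Nat.Coprimality as Coprime
  open import Data.Rational using (toℚᵘ; mkℚ; 0ℚ; 1ℚ; _+_; _*_; _-_; _≤_; _<_; *≤*; *<*; Positive; nonNegative)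
  open import Data.Rational.Properties
  open import Data.Rational.Solver using (module +-*-Solver)
  open import Data.Rational.Unnormalised as ℚᵘ using (mkℚᵘ)
  import Data.Rational.Unnormalised.Properties as ℚᵘ
  open import Data.Sum using (_⊎_; inj₁; inj₂)
  import Data.Sum as Sum
  open import Relation.Binary.PropositionalEquality
  open import Relation.Nullary using (¬_; yes; no; Dec; contradiction)
  open import Relation.Nullary.Decidable using (does)
  open +-*-Solver

  private
    ℕtoℚ-normal : ∀ m → ℕtoℚ m ≡ mkℚ (+ m) 0 (Coprime.sym (Coprime.1-coprimeTo m))
    ℕtoℚ-normal m = normalize-coprime (Coprime.sym (Coprime.1-coprimeTo m))

    recip-normal : ∀ m → recip (suc m) ≡ mkℚ (+ 1) m (Coprime.1-coprimeTo (suc m))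
    recip-normal m = normalize-coprime (Coprime.1-coprimeTo (suc m))

    toℚᵘ-ℕtoℚ : ∀ m → toℚᵘ (ℕtoℚ m) ≡ mkℚᵘ (+ m) 0
    toℚᵘ-ℕtoℚ m rewrite ℕtoℚ-normal m = refl

  ℕtoℚ-cancel-≤ : ∀ a b → ℕtoℚ a ≤ ℕtoℚ b → a ℕ.≤ b
  ℕtoℚ-cancel-≤ a b a≤b rewrite ℕtoℚ-normal a | ℕtoℚ-normal b with a≤b
  ... | *≤* a≤b′ rewrite ℤ.*-identityʳ (+ a) | ℤ.*-identityʳ (+ b) = ℤ.drop‿+≤+ a≤b′

  ℕtoℚ-cancel-< : ∀ a b → ℕtoℚ a < ℕtoℚ b → a ℕ.< b
  ℕtoℚ-cancel-< a b a<b rewrite ℕtoℚ-normal a | ℕtoℚ-normal b with a<b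
  ... | *<* a<b′ rewrite ℤ.*-identityʳ (+ a) | ℤ.*-identityʳ (+ b) = ℤ.drop‿+<+ a<b′

  ℕtoℚ-+ : ∀ a b → ℕtoℚ (a ℕ.+ b) ≡ ℕtoℚ a + ℕtoℚ b
  ℕtoℚ-+ a b = toℚᵘ-injective (ℚᵘ.≃-trans (ℚᵘ.≃-reflexive (toℚᵘ-ℕtoℚ (a ℕ.+ b)))
    (ℚᵘ.≃-trans sum (ℚᵘ.≃-sym (ℚᵘ.≃-trans (toℚᵘ-homo-+ (ℕtoℚ a) (ℕtoℚ b))
                                          (ℚᵘ.≃-reflexive (cong₂ ℚᵘ._+_ (toℚᵘ-ℕtoℚ a) (toℚᵘ-ℕtoℚ b)))))))
    where
    sum : mkℚᵘ (+ (a ℕ.+ b)) 0 ℚᵘ.≃ (mkℚᵘ (+ a) 0 ℚᵘ.+ mkℚᵘ (+ b) 0)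
    sum = ℚᵘ.*≡* (trans (ℤ.*-identityʳ _) (trans (ℤ.pos-+ a b)
            (sym (trans (ℤ.*-identityʳ _) (cong₂ ℤ._+_ (ℤ.*-identityʳ (+ a)) (ℤ.*-identityʳ (+ b)))))))

  ℕtoℚ-* : ∀ a b → ℕtoℚ (a ℕ.* b) ≡ ℕtoℚ a * ℕtoℚ b
  ℕtoℚ-* a b = toℚᵘ-injective (ℚᵘ.≃-trans (ℚᵘ.≃-reflexive (toℚᵘ-ℕtoℚ (a ℕ.* b)))
    (ℚᵘ.≃-trans product (ℚᵘ.≃-sym (ℚᵘ.≃-trans (toℚᵘ-homo-* (ℕtoℚ a) (ℕtoℚ b))
                                              (ℚᵘ.≃-reflexive (cong₂ ℚᵘ._*_ (toℚᵘ-ℕtoℚ a) (toℚᵘ-ℕtoℚ b)))))))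
    where
    product : mkℚᵘ (+ (a ℕ.* b)) 0 ℚᵘ.≃ (mkℚᵘ (+ a) 0 ℚᵘ.* mkℚᵘ (+ b) 0)
    product = ℚᵘ.*≡* (trans (ℤ.*-identityʳ _) (trans (ℤ.pos-* a b) (sym (ℤ.*-identityʳ _))))

  ℕtoℚ*recip : ∀ m → ℕtoℚ (suc m) * recip (suc m) ≡ 1ℚ
  ℕtoℚ*recip m rewrite ℕtoℚ-normal (suc m) | recip-normal m =
    *-inverseʳ (mkℚ (+ suc m) 0 (Coprime.sym (Coprime.1-coprimeTo (suc m))))

  ℕtoℚ-positive : ∀ m → Positive (ℕtoℚ (suc m))
  ℕtoℚ-positive m rewrite ℕtoℚ-normal (suc m) = _

  0≤ℕtoℚ : ∀ m → 0ℚ ≤ ℕtoℚ m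
  0≤ℕtoℚ m rewrite ℕtoℚ-normal m = nonNegative⁻¹ _

  0≤recip : ∀ m → 0ℚ ≤ recip m
  0≤recip zero    = ≤-refl
  0≤recip (suc m) rewrite recip-normal m = nonNegative⁻¹ _

  recip-square : ∀ a → recip (suc a ℕ.* suc a) ≡ recip (suc a) * recip (suc a)
  recip-square a = begin
    recip A²                              ≡⟨ sym (*-identityˡ (recip A²)) ⟩
    1ℚ * recip A²                         ≡⟨ cong (_* recip A²) (sym squares-cancel) ⟩
    (ρ * ρ * ℕtoℚ A²) * recip A²          ≡⟨ *-assoc (ρ * ρ) (ℕtoℚ A²) (recip A²) ⟩
    (ρ * ρ) * (ℕtoℚ A² * recip A²)        ≡⟨ cong ((ρ * ρ) *_) (ℕtoℚ*recip (a ℕ.+ a ℕ.* suc a)) ⟩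
    (ρ * ρ) * 1ℚ                          ≡⟨ *-identityʳ (ρ * ρ) ⟩
    ρ * ρ                                 ∎
    where
    open ≡-Reasoning
    A² = suc a ℕ.* suc a
    ρ = recip (suc a)
    R = ℕtoℚ (suc a)
    squares-cancel : ρ * ρ * ℕtoℚ A² ≡ 1ℚ
    squares-cancel = begin
      ρ * ρ * ℕtoℚ A²    ≡⟨ cong (ρ * ρ *_) (ℕtoℚ-* (suc a) (suc a)) ⟩
      ρ * ρ * (R * R)    ≡⟨ solve 2 (λ ρ R → ρ :* ρ :* (R :* R) := (R :* ρ) :* (R :* ρ)) refl ρ R ⟩
      (R * ρ) * (R * ρ)  ≡⟨ cong₂ _*_ (ℕtoℚ*recip a) (ℕtoℚ*recip a) ⟩
      1ℚ * 1ℚ            ≡⟨ *-identityˡ 1ℚ ⟩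
      1ℚ                 ∎

  <-from-squares : ∀ x y → 0ℚ ≤ y → x * x < y * y → x < y
  <-from-squares x y 0≤y x²<y² with x <? y
  ... | yes x<y = x<y
  ... | no  x≮y = contradiction (<-≤-trans x²<y² y²≤x²) (<-irrefl refl)
    where
    y≤x : y ≤ x
    y≤x = ≮⇒≥ x≮y
    y²≤x² : y * y ≤ x * x
    y²≤x² = ≤-trans (*-monoʳ-≤-nonNeg y {{nonNegative 0≤y}} y≤x)
                    (*-monoˡ-≤-nonNeg x {{nonNegative (≤-trans 0≤y y≤x)}} y≤x)

  LtSqrt⇒< : ∀ {x b ε} q → 0ℚ ≤ b → ε ≤ recip (suc q) * recip (suc q) → LtSqrt x b ε → x < b * recip (suc q)
  LtSqrt⇒< {x} {b} {ε} q 0≤b ε≤ρ² (inj₁ x<0) = <-≤-trans x<0 0≤bρ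
    where
    0≤bρ : 0ℚ ≤ b * recip (suc q)
    0≤bρ = ≤-trans (≤-reflexive (sym (*-zeroˡ (recip (suc q))))) (*-monoʳ-≤-nonNeg (recip (suc q)) {{nonNegative (0≤recip (suc q))}} 0≤b)
  LtSqrt⇒< {x} {b} {ε} q 0≤b ε≤ρ² (inj₂ x²<b²ε) = <-from-squares x (b * ρ) 0≤bρ (<-≤-trans x²<b²ε b²ε≤)
    where
    ρ = recip (suc q)
    0≤bρ : 0ℚ ≤ b * ρ
    0≤bρ = ≤-trans (≤-reflexive (sym (*-zeroˡ ρ))) (*-monoʳ-≤-nonNeg ρ {{nonNegative (0≤recip (suc q))}} 0≤b)
    0≤b² : 0ℚ ≤ b * b
    0≤b² = ≤-trans (≤-reflexive (sym (*-zeroˡ b))) (*-monoʳ-≤-nonNeg b {{nonNegative 0≤b}} 0≤b)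
    b²ε≤ : b * b * ε ≤ (b * ρ) * (b * ρ)
    b²ε≤ = ≤-trans (*-monoˡ-≤-nonNeg (b * b) {{nonNegative 0≤b²}} ε≤ρ²)
                   (≤-reflexive (solve 2 (λ b ρ → (b :* b) :* (ρ :* ρ) := (b :* ρ) :* (b :* ρ)) refl b ρ))

  -<⇒<+ : ∀ a b c → a - b < c → a < b + c
  -<⇒<+ a b c a-b<c = subst₂ _<_ (solve 2 (λ a b → (a :- b) :+ b := a) refl a b) (+-comm c b) (+-monoˡ-< b a-b<c)

  inSum-bound : ∀ q I N ε → ε < recip (suc q ℕ.* suc q) → ℕtoℚ I ≤ (ε * recip 2) * ℕtoℚ N →
    2 ℕ.* (suc q ℕ.* suc q) ℕ.* I ℕ.≤ N
  inSum-bound q I N ε ε<ρ² I≤ = ℕtoℚ-cancel-≤ _ _ (begin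
    ℕtoℚ (2 ℕ.* Q² ℕ.* I)                      ≡⟨ trans (ℕtoℚ-* (2 ℕ.* Q²) I) (cong (_* ℕtoℚ I) (ℕtoℚ-* 2 Q²)) ⟩
    (ℕtoℚ 2 * ℕtoℚ Q²) * ℕtoℚ I                ≤⟨ *-monoˡ-≤-nonNeg (ℕtoℚ 2 * ℕtoℚ Q²) {{nonNegative 0≤2Q²}} I≤ ⟩
    (ℕtoℚ 2 * ℕtoℚ Q²) * ((ε * recip 2) * ℕtoℚ N)
      ≤⟨ *-monoˡ-≤-nonNeg (ℕtoℚ 2 * ℕtoℚ Q²) {{nonNegative 0≤2Q²}}
           (*-monoʳ-≤-nonNeg (ℕtoℚ N) {{nonNegative (0≤ℕtoℚ N)}}
             (*-monoʳ-≤-nonNeg (recip 2) {{nonNegative (0≤recip 2)}} (<⇒≤ ε<ρ²))) ⟩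
    (ℕtoℚ 2 * ℕtoℚ Q²) * ((recip Q² * recip 2) * ℕtoℚ N)
      ≡⟨ solve 5 (λ B A a b N → (B :* A) :* ((a :* b) :* N) := (A :* a) :* ((B :* b) :* N)) refl
                 (ℕtoℚ 2) (ℕtoℚ Q²) (recip Q²) (recip 2) (ℕtoℚ N) ⟩
    (ℕtoℚ Q² * recip Q²) * ((ℕtoℚ 2 * recip 2) * ℕtoℚ N)
      ≡⟨ cong₂ (λ u v → u * (v * ℕtoℚ N)) (ℕtoℚ*recip (q ℕ.+ q ℕ.* suc q)) (ℕtoℚ*recip 1) ⟩
    1ℚ * (1ℚ * ℕtoℚ N)                         ≡⟨ trans (*-identityˡ (1ℚ * ℕtoℚ N)) (*-identityˡ (ℕtoℚ N)) ⟩
    ℕtoℚ N                                     ∎)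
    where
    open ≤-Reasoning
    Q² = suc q ℕ.* suc q
    0≤2Q² : 0ℚ ≤ ℕtoℚ 2 * ℕtoℚ Q²
    0≤2Q² = subst (0ℚ ≤_) (ℕtoℚ-* 2 Q²) (0≤ℕtoℚ (2 ℕ.* Q²))

  private
    cleared : ∀ r₀ q x b → x < b * recip (suc q) → x * (ℕtoℚ (suc r₀) * ℕtoℚ (suc q)) < b * ℕtoℚ (suc r₀)
    cleared r₀ q x b x<bρ = subst (x * (R * Q) <_) bρRQ≡bR (*-monoˡ-<-pos (R * Q) {{RQ-positive}} x<bρ)
      where
      R = ℕtoℚ (suc r₀)
      Q = ℕtoℚ (suc q)
      ρ = recip (suc q)
      RQ-positive : Positive (R * Q)
      RQ-positive = subst Positive (ℕtoℚ-* (suc r₀) (suc q)) (ℕtoℚ-positive (q ℕ.+ r₀ ℕ.* suc q))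
      bρRQ≡bR : (b * ρ) * (R * Q) ≡ b * R
      bρRQ≡bR = begin
        (b * ρ) * (R * Q) ≡⟨ solve 4 (λ b ρ R Q → (b :* ρ) :* (R :* Q) := b :* R :* (Q :* ρ)) refl b ρ R Q ⟩
        b * R * (Q * ρ)   ≡⟨ cong (b * R *_) (ℕtoℚ*recip q) ⟩
        b * R * 1ℚ        ≡⟨ *-identityʳ (b * R) ⟩
        b * R             ∎
        where open ≡-Reasoning

    ε≤ρ² : ∀ q ε → ε < recip (suc q ℕ.* suc q) → ε ≤ recip (suc q) * recip (suc q)
    ε≤ρ² q ε ε<ρ² = ≤-trans (<⇒≤ ε<ρ²) (≤-reflexive (recip-square q))

  does-∧-false : ∀ {P R : Set} (p? : Dec P) (r? : Dec R) → (does p? ∧ does r?) ≡ false → ¬ P ⊎ ¬ R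
  does-∧-false (yes _) (yes _) ()
  does-∧-false (yes _) (no ¬r) _ = inj₂ ¬r
  does-∧-false (no ¬p) _       _ = inj₁ ¬p

  part-size-bound : ∀ r₀ q n s ε → ε < recip (suc q ℕ.* suc q) →
    LtSqrt (recip (suc r₀) * ℕtoℚ n - ℕtoℚ s) (ℕtoℚ (2 ℕ.* n)) ε →
    suc q ℕ.* n ℕ.< suc r₀ ℕ.* suc q ℕ.* s ℕ.+ 2 ℕ.* n ℕ.* suc r₀
  part-size-bound r₀ q n s ε ε<ρ² small-deficit = ℕtoℚ-cancel-< _ _ (subst₂ _<_ (sym ℕ-lhs) (sym ℕ-rhs)
    (-<⇒<+ (Q * N) (R * Q * S) _ (subst (_< ℕtoℚ (2 ℕ.* n) * R) x·RQ (cleared r₀ q (recip (suc r₀) * N - S) (ℕtoℚ (2 ℕ.* n)) deficit<))))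
    where
    R = ℕtoℚ (suc r₀)
    Q = ℕtoℚ (suc q)
    N = ℕtoℚ n
    S = ℕtoℚ s
    deficit< : recip (suc r₀) * N - S < ℕtoℚ (2 ℕ.* n) * recip (suc q)
    deficit< = LtSqrt⇒< q (0≤ℕtoℚ (2 ℕ.* n)) (ε≤ρ² q ε ε<ρ²) small-deficit
    x·RQ : (recip (suc r₀) * N - S) * (R * Q) ≡ Q * N - R * Q * S
    x·RQ = begin
      (recip (suc r₀) * N - S) * (R * Q)
        ≡⟨ solve 5 (λ ρ N S R Q → (ρ :* N :- S) :* (R :* Q) := Q :* N :* (R :* ρ) :- R :* Q :* S) refl (recip (suc r₀)) N S R Q ⟩
      Q * N * (R * recip (suc r₀)) - R * Q * S ≡⟨ cong (λ z → Q * N * z - R * Q * S) (ℕtoℚ*recip r₀) ⟩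
      Q * N * 1ℚ - R * Q * S                   ≡⟨ cong (_- R * Q * S) (*-identityʳ (Q * N)) ⟩
      Q * N - R * Q * S                        ∎
      where open ≡-Reasoning
    ℕ-lhs : ℕtoℚ (suc q ℕ.* n) ≡ Q * N
    ℕ-lhs = ℕtoℚ-* (suc q) n
    ℕ-rhs : ℕtoℚ (suc r₀ ℕ.* suc q ℕ.* s ℕ.+ 2 ℕ.* n ℕ.* suc r₀) ≡ R * Q * S + ℕtoℚ (2 ℕ.* n) * R
    ℕ-rhs = trans (ℕtoℚ-+ (suc r₀ ℕ.* suc q ℕ.* s) (2 ℕ.* n ℕ.* suc r₀))
      (cong₂ _+_ (trans (ℕtoℚ-* (suc r₀ ℕ.* suc q) s) (cong (_* S) (ℕtoℚ-* (suc r₀) (suc q)))) (ℕtoℚ-* (2 ℕ.* n) (suc r₀)))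

  ∉L-degree-bound : ∀ r₀ q n d ε → ε < recip (suc q ℕ.* suc q) →
    sqrtLeᵇ (ℕtoℚ 5 * ℕtoℚ n) ε ((ℕtoℚ 1 - recip (suc r₀)) * ℕtoℚ n - ℕtoℚ d) ≡ false →
    suc r₀ ℕ.* suc q ℕ.* n ℕ.< suc q ℕ.* n ℕ.+ suc r₀ ℕ.* suc q ℕ.* d ℕ.+ 5 ℕ.* n ℕ.* suc r₀
  ∉L-degree-bound r₀ q n d ε ε<ρ² not-low = ℕtoℚ-cancel-< _ _ (subst₂ _<_ (sym ℕ-lhs) (sym ℕ-rhs)
    (-<⇒<+ (R * Q * N) (Q * N) _ (-<⇒<+ (R * Q * N - Q * N) (R * Q * D) _ (subst (_< b * R) a·RQ (cleared r₀ q a b gap<)))))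
    where
    R = ℕtoℚ (suc r₀)
    Q = ℕtoℚ (suc q)
    N = ℕtoℚ n
    D = ℕtoℚ d
    b = ℕtoℚ 5 * N
    a = (1ℚ - recip (suc r₀)) * N - D
    gap-small : LtSqrt a b ε
    gap-small = Sum.map ≰⇒> ≰⇒> (does-∧-false (0ℚ ≤? a) ((b * b * ε) ≤? (a * a)) not-low)
    gap< : a < b * recip (suc q)
    gap< = LtSqrt⇒< q (subst (0ℚ ≤_) (ℕtoℚ-* 5 n) (0≤ℕtoℚ (5 ℕ.* n))) (ε≤ρ² q ε ε<ρ²) gap-small
    a·RQ : a * (R * Q) ≡ R * Q * N - Q * N - R * Q * D
    a·RQ = begin
      a * (R * Q)
        ≡⟨ solve 5 (λ ρ N D R Q → ((con 1ℚ :- ρ) :* N :- D) :* (R :* Q) := R :* Q :* N :- Q :* N :* (R :* ρ) :- R :* Q :* D)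
                 refl (recip (suc r₀)) N D R Q ⟩
      R * Q * N - Q * N * (R * recip (suc r₀)) - R * Q * D ≡⟨ cong (λ z → R * Q * N - Q * N * z - R * Q * D) (ℕtoℚ*recip r₀) ⟩
      R * Q * N - Q * N * 1ℚ - R * Q * D                   ≡⟨ cong (λ z → R * Q * N - z - R * Q * D) (*-identityʳ (Q * N)) ⟩
      R * Q * N - Q * N - R * Q * D                        ∎
      where open ≡-Reasoning
    ℕ-lhs : ℕtoℚ (suc r₀ ℕ.* suc q ℕ.* n) ≡ R * Q * N
    ℕ-lhs = trans (ℕtoℚ-* (suc r₀ ℕ.* suc q) n) (cong (_* N) (ℕtoℚ-* (suc r₀) (suc q)))
    ℕ-rhs : ℕtoℚ (suc q ℕ.* n ℕ.+ suc r₀ ℕ.* suc q ℕ.* d ℕ.+ 5 ℕ.* n ℕ.* suc r₀) ≡ Q * N + (R * Q * D + b * R)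
    ℕ-rhs = begin
      ℕtoℚ (suc q ℕ.* n ℕ.+ suc r₀ ℕ.* suc q ℕ.* d ℕ.+ 5 ℕ.* n ℕ.* suc r₀)
        ≡⟨ trans (ℕtoℚ-+ (suc q ℕ.* n ℕ.+ suc r₀ ℕ.* suc q ℕ.* d) (5 ℕ.* n ℕ.* suc r₀))
                 (cong (_+ ℕtoℚ (5 ℕ.* n ℕ.* suc r₀)) (ℕtoℚ-+ (suc q ℕ.* n) (suc r₀ ℕ.* suc q ℕ.* d))) ⟩
      ℕtoℚ (suc q ℕ.* n) + ℕtoℚ (suc r₀ ℕ.* suc q ℕ.* d) + ℕtoℚ (5 ℕ.* n ℕ.* suc r₀)
        ≡⟨ cong₂ (λ u v → u + v + ℕtoℚ (5 ℕ.* n ℕ.* suc r₀)) (ℕtoℚ-* (suc q) n)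
                 (trans (ℕtoℚ-* (suc r₀ ℕ.* suc q) d) (cong (_* D) (ℕtoℚ-* (suc r₀) (suc q)))) ⟩
      Q * N + R * Q * D + ℕtoℚ (5 ℕ.* n ℕ.* suc r₀)
        ≡⟨ cong (λ z → Q * N + R * Q * D + z) (trans (ℕtoℚ-* (5 ℕ.* n) (suc r₀)) (cong (_* R) (ℕtoℚ-* 5 n))) ⟩
      Q * N + R * Q * D + b * R
        ≡⟨ +-assoc (Q * N) (R * Q * D) (b * R) ⟩
      Q * N + (R * Q * D + b * R) ∎
      where open ≡-Reasoning

module ExtremalStructure where

  open import Defs hiding (sym)
  open Counting
  open Partitions
  open Books using (IsClique; book-from-clique)
  open TypeGraph
  open import Data.Bool using (Bool; true; false; _∧_; not; if_then_else_)
  open import Data.Bool.Properties using (T-≡; ∧-comm; ∧-identityʳ)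
  open import Data.Empty using (⊥)
  open import Data.Fin using (Fin; zero; suc; _↑ˡ_; punchIn)
  open import Data.Fin.Patterns
  open import Data.Fin.Properties using (suc-injective; 0≢1+n; ↑ˡ-injective; punchIn-injective; punchInᵢ≢i)
  open import Data.Nat using (ℕ; zero; suc; _+_; _*_; _≤_; _<_; _≤ᵇ_; _≤?_; z≤n; s≤s; >-nonZero)
  open import Data.Nat.Properties hiding (_≟_; 0≢1+n; suc-injective)
  open import Data.Nat.Tactic.RingSolver using (solve-∀)
  open import Data.Product using (Σ; _×_; _,_; proj₁; proj₂)
  open import Data.Sum using (_⊎_; inj₁; inj₂)
  open import Data.Vec.Functional using (_∷_; [])
  import Data.Vec.Functional as Vector
  open import Function using (_∘_; id; Equivalence)
  open import Function.Definitions using (Injective)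
  open import Relation.Binary.PropositionalEquality
  open import Relation.Nullary using (¬_; yes; no; contradiction)

  module ComparisonGraph {n r′ : ℕ} (c : Fin n → Fin (2 + r′)) (s : Ty r′ → Fin n)
    (s-part : ∀ t → c (s t) ≡ partOf t) (s-cyc-injective : ∀ a b → s (cyc a) ≡ s (cyc b) → a ≡ b) where

    typeOfPart : Fin (2 + r′) → Ty r′
    typeOfPart 0F            = t1
    typeOfPart 1F            = t2
    typeOfPart (suc (suc j)) = tp j

    τ : Fin n → Ty r′
    τ w = if w == s t3 then t3 else if w == s t4 then t4 else if w == s t5 then t5 else typeOfPart (c w)

    H : Graph n
    H = blowUp τ

    private
      s-cyc≢ : ∀ {a b} → a ≢ b → s (cyc a) ≢ s (cyc b)
      s-cyc≢ a≢b = a≢b ∘ s-cyc-injective _ _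

      s-tp≢s-cyc : ∀ j a → s (tp j) ≢ s (cyc a)
      s-tp≢s-cyc j a eq = low≢high (partSide a) (trans (sym (s-part (cyc a))) (trans (cong c (sym eq)) (s-part (tp j))))
        where
        low≢high : ∀ x → x ↑ˡ r′ ≢ suc (suc j)
        low≢high 0F ()
        low≢high 1F ()

    τ-plain : ∀ w → w ≢ s t3 → w ≢ s t4 → w ≢ s t5 → τ w ≡ typeOfPart (c w)
    τ-plain w ≢t3 ≢t4 ≢t5 rewrite ≢⇒==-false ≢t3 | ≢⇒==-false ≢t4 | ≢⇒==-false ≢t5 = refl

    τ-section : ∀ t → τ (s t) ≡ t
    τ-section t1 = trans (τ-plain (s t1) (s-cyc≢ λ ()) (s-cyc≢ λ ()) (s-cyc≢ λ ())) (cong typeOfPart (s-part t1))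
    τ-section t2 = trans (τ-plain (s t2) (s-cyc≢ λ ()) (s-cyc≢ λ ()) (s-cyc≢ λ ())) (cong typeOfPart (s-part t2))
    τ-section t3 rewrite ==-refl (s t3) = refl
    τ-section t4 rewrite ≢⇒==-false (s-cyc≢ {3F} {2F} λ ()) | ==-refl (s t4) = refl
    τ-section t5 rewrite ≢⇒==-false (s-cyc≢ {4F} {2F} λ ()) | ≢⇒==-false (s-cyc≢ {4F} {3F} λ ()) | ==-refl (s t5) = refl
    τ-section (tp j) = trans (τ-plain (s (tp j)) (s-tp≢s-cyc j 2F) (s-tp≢s-cyc j 3F) (s-tp≢s-cyc j 4F))
                             (cong typeOfPart (s-part (tp j)))

    τ-cases : ∀ w → (w ≡ s t3 × τ w ≡ t3) ⊎ (w ≡ s t4 × τ w ≡ t4) ⊎ (w ≡ s t5 × τ w ≡ t5) ⊎ τ w ≡ typeOfPart (c w)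
    τ-cases w with w == s t3 in e₃
    ... | true = inj₁ (==⇒≡ e₃ , refl)
    ... | false with w == s t4 in e₄
    ...   | true = inj₂ (inj₁ (==⇒≡ e₄ , refl))
    ...   | false with w == s t5 in e₅
    ...     | true  = inj₂ (inj₂ (inj₁ (==⇒≡ e₅ , refl)))
    ...     | false = inj₂ (inj₂ (inj₂ refl))

    τ-part : ∀ w → partOf (τ w) ≡ c w
    τ-part w with τ-cases w
    ... | inj₁ (refl , τw≡t3)               rewrite τw≡t3 = sym (s-part t3)
    ... | inj₂ (inj₁ (refl , τw≡t4))        rewrite τw≡t4 = sym (s-part t4)
    ... | inj₂ (inj₂ (inj₁ (refl , τw≡t5))) rewrite τw≡t5 = sym (s-part t5)
    ... | inj₂ (inj₂ (inj₂ τw≡plain))       rewrite τw≡plain = part-of-type (c w)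
      where
      part-of-type : ∀ i → partOf (typeOfPart i) ≡ i
      part-of-type 0F            = refl
      part-of-type 1F            = refl
      part-of-type (suc (suc j)) = refl

    extraAt : Fin n → ℕ
    extraAt w = 𝟙 (w == s t4) + 𝟙 (w == s t5)

    extraAt-pos : ∀ w → IsExtra (τ w) → 1 ≤ extraAt w
    extraAt-pos w extra with τ-cases w | extra
    ... | inj₁ (_ , τw≡t3) | inj₁ τw≡t4 with () ← trans (sym τw≡t3) τw≡t4
    ... | inj₁ (_ , τw≡t3) | inj₂ τw≡t5 with () ← trans (sym τw≡t3) τw≡t5
    ... | inj₂ (inj₁ (refl , _)) | _ rewrite ==-refl (s t4) = s≤s z≤n
    ... | inj₂ (inj₂ (inj₁ (refl , _))) | _ rewrite ==-refl (s t5) = m≤n+m 1 _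
    ... | inj₂ (inj₂ (inj₂ τw≡plain)) | extra′ = contradiction (subst IsExtra τw≡plain extra′) (plain-not-extra (c w))
      where
      plain-not-extra : ∀ i → ¬ IsExtra (typeOfPart i)
      plain-not-extra 0F            (inj₁ ())
      plain-not-extra 0F            (inj₂ ())
      plain-not-extra 1F            (inj₁ ())
      plain-not-extra 1F            (inj₂ ())
      plain-not-extra (suc (suc j)) (inj₁ ())
      plain-not-extra (suc (suc j)) (inj₂ ())

    τ-parts-differ : ∀ a b → (c a == c b) ≡ false → partOf (τ a) ≢ partOf (τ b)
    τ-parts-differ a b a∉b eq = ==-false⇒≢ a∉b (trans (sym (τ-part a)) (trans eq (τ-part b)))

    cross-pairs-covered : ∀ a b → 𝟙 (not (c a == c b)) ≤ 𝟙 (adj H a b) + (extraAt a + extraAt b)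
    cross-pairs-covered a b with c a == c b in a∉b | tyAdj (τ a) (τ b) in a≁b
    ... | true  | _     = z≤n
    ... | false | true  = s≤s z≤n
    ... | false | false with missing-cross-pairs (τ a) (τ b) (τ-parts-differ a b a∉b) a≁b
    ...   | inj₁ extra-a = ≤-trans (extraAt-pos a extra-a) (≤-trans (m≤m+n _ (extraAt b)) (m≤n+m _ 0))
    ...   | inj₂ extra-b = ≤-trans (extraAt-pos b extra-b) (≤-trans (m≤n+m _ (extraAt a)) (m≤n+m _ 0))

    ∑∑-extra : ∑[ a < n ] ∑[ b < n ] (extraAt a + extraAt b) ≡ 4 * n
    ∑∑-extra = begin
      ∑[ a < n ] ∑[ b < n ] (extraAt a + extraAt b)          ≡⟨ ∑∑-distrib-+ {n} _ _ ⟩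
      ∑[ a < n ] ∑[ b < n ] extraAt a + ∑[ a < n ] ∑[ b < n ] extraAt b
        ≡⟨ cong₂ _+_ (trans (sum-cong-≗ {n} λ a → ∑-const n (extraAt a)) (sym (*-distribˡ-sum {n} n extraAt)))
                     (∑-const n (∑[ b < n ] extraAt b)) ⟩
      n * ∑[ w < n ] extraAt w + n * ∑[ w < n ] extraAt w     ≡⟨ cong (λ x → n * x + n * x) ∑-extraAt ⟩
      n * 2 + n * 2                                           ≡⟨ trans (sym (*-distribˡ-+ n 2 2)) (*-comm n 4) ⟩
      4 * n ∎
      where
      open ≡-Reasoning
      ∑-== : ∀ x → ∑[ w < n ] 𝟙 (w == x) ≡ 1
      ∑-== x = trans (sum-cong-≗ {n} λ w → sym (*-identityʳ (𝟙 (w == x)))) (∑-pickʳ x (λ _ → 1))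
      ∑-extraAt : ∑[ w < n ] extraAt w ≡ 2
      ∑-extraAt = trans (∑-distrib-+ {n} _ _) (cong₂ _+_ (∑-== (s t4)) (∑-== (s t5)))

  module GreedyBook {n r k : ℕ} (G : Graph n) (c : Fin n → Fin r) (bfree : BFree r k G)
    (Q : ℕ) (k≥1 : 1 ≤ k) (Q≥1 : 1 ≤ Q) where

    private
      A = adj G

    good : Fin n → Bool
    good w = Q * crossMiss G c w ≤ᵇ n

    nbad : ℕ
    nbad = ∑[ w < n ] 𝟙 (not (good w))

    commonNbr : ∀ {a} → (Fin a → Fin n) → Fin n → Bool
    commonNbr κ b = Vector.foldr _∧_ true (λ i → A (κ i) b)

    commonNbr-adj : ∀ {a} (κ : Fin a → Fin n) b → commonNbr κ b ≡ true → ∀ i → A (κ i) b ≡ true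
    commonNbr-adj κ b common zero    = proj₁ (∧-≡true {A (κ zero) b} common)
    commonNbr-adj κ b common (suc i) = commonNbr-adj (κ ∘ suc) b (proj₂ (∧-≡true {A (κ zero) b} common)) i

    commonIn : ∀ {a} → (Fin a → Fin n) → Fin r → ℕ
    commonIn κ j = ∑[ b < n ] 𝟙 ((c b == j) ∧ commonNbr κ b)

    good-common-neighbour : ∀ {a} (κ : Fin a → Fin n) j → nbad < commonIn κ j →
      Σ (Fin n) λ w → c w ≡ j × commonNbr κ w ≡ true × Q * crossMiss G c w ≤ n
    good-common-neighbour κ j nbad<common = w , ==⇒≡ w-part , w-common , w-good
      where
      candidate : Fin n → Bool
      candidate b = ((c b == j) ∧ commonNbr κ b) ∧ good b
      common≤ : commonIn κ j ≤ ∑[ b < n ] 𝟙 (candidate b) + nbad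
      common≤ = ≤-trans (∑-mono-≤ λ b → ≤-trans (≤-reflexive (𝟙-split _ (good b)))
                                              (+-monoʳ-≤ (𝟙 (candidate b)) (𝟙-∧-≤ʳ _ (not (good b)))))
                      (≤-reflexive (∑-distrib-+ {n} _ _))
      chosen : Σ (Fin n) λ w → candidate w ≡ true
      chosen = witness candidate (+-cancelʳ-≤ nbad 1 _ (≤-trans nbad<common common≤))
      w = proj₁ chosen
      w-part,common = proj₁ (∧-≡true {(c w == j) ∧ commonNbr κ w} (proj₂ chosen))
      w-part = proj₁ (∧-≡true {c w == j} w-part,common)
      w-common = proj₂ (∧-≡true {c w == j} w-part,common)
      w-good = ≤ᵇ⇒≤ (Q * crossMiss G c w) n (Equivalence.from T-≡ (proj₂ (∧-≡true {(c w == j) ∧ commonNbr κ w} (proj₂ chosen))))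

    single-clique : ∀ x → IsClique G (x ∷ [])
    single-clique x 0F 0F 0≢0 = contradiction refl 0≢0

    clique-extend : ∀ {a} {κ : Fin a → Fin n} {w} → IsClique G κ → commonNbr κ w ≡ true → IsClique G (w ∷ κ)
    clique-extend κ-clique common zero    zero    0≢0 = contradiction refl 0≢0
    clique-extend {κ = κ} {w} κ-clique common zero (suc j) _ = trans (Graph.sym G w (κ j)) (commonNbr-adj κ w common j)
    clique-extend {κ = κ} {w} κ-clique common (suc i) zero _ = commonNbr-adj κ w common i
    clique-extend κ-clique common (suc i) (suc j) i≢j = κ-clique i j (i≢j ∘ cong suc)

    commonIn-extend : ∀ {a} (κ : Fin a → Fin n) w j → c w ≢ j → commonIn κ j ≤ commonIn (w ∷ κ) j + crossMiss G c w
    commonIn-extend κ w j w∉j = ≤-trans (∑-mono-≤ pointwise) (≤-reflexive (∑-distrib-+ {n} _ _))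
      where
      keep : ∀ x y → 𝟙 y ≤ 𝟙 (x ∧ y) + 𝟙 (not x)
      keep true  y     = m≤m+n (𝟙 y) 0
      keep false true  = ≤-refl
      keep false false = z≤n
      pointwise : ∀ b → 𝟙 ((c b == j) ∧ commonNbr κ b) ≤ 𝟙 ((c b == j) ∧ commonNbr (w ∷ κ) b) + 𝟙 (not (c w == c b) ∧ not (A w b))
      pointwise b with c b == j in b∈j
      ... | false = z≤n
      ... | true rewrite ≢⇒==-false {x = c w} {c b} (λ eq → w∉j (trans eq (==⇒≡ b∈j))) = keep (A w b) (commonNbr κ b)

    nbad<commonIn : ∀ p {a} (κ : Fin a → Fin n) j → suc p * n + Q * nbad + Q * k ≤ Q * commonIn κ j → nbad < commonIn κ j
    nbad<commonIn p κ j large = *-cancelˡ-< Q nbad _ (begin-strict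
      Q * nbad                        <⟨ m<m+n (Q * nbad) (*-mono-≤ Q≥1 k≥1) ⟩
      Q * nbad + Q * k                ≤⟨ +-monoˡ-≤ (Q * k) (m≤n+m (Q * nbad) (suc p * n)) ⟩
      suc p * n + Q * nbad + Q * k    ≤⟨ large ⟩
      Q * commonIn κ j                ∎)
      where open ≤-Reasoning

    -- The term Q * nbad guarantees a good common neighbour in the next part; adding it to the clique
    -- costs at most n / Q common neighbours in every other part, which the budget p * n pays for,
    -- so at least k common neighbours remain after the last step.
    greedy-book : ∀ p a (κ : Fin a → Fin n) → a + p ≡ r → IsClique G κ →
      (π : Fin (suc p) → Fin r) → Injective _≡_ _≡_ π →
      (∀ l → p * n + Q * nbad + Q * k ≤ Q * commonIn κ (π l)) → ⊥
    greedy-book zero a κ a+0≡r κ-clique π _ large with refl ← trans (sym (+-identityʳ a)) a+0≡r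
      with g , g-inj , g-common ← distinct-witnesses k _ (*-cancelˡ-≤ Q {{>-nonZero Q≥1}} (≤-trans (m≤n+m _ _) (large zero)))
      = bfree (book-from-clique G κ g κ-clique g-inj λ i j →
          commonNbr-adj κ (g j) (proj₂ (∧-≡true {c (g j) == π zero} (g-common j))) i)
    greedy-book (suc p) a κ a+p≡r κ-clique π π-inj large
      with w , w-part , w-common , w-good ← good-common-neighbour κ (π zero) (nbad<commonIn p κ (π zero) (large zero))
      = greedy-book p (suc a) (w ∷ κ) (trans (sym (+-suc a p)) a+p≡r) (clique-extend κ-clique w-common)
                    (π ∘ suc) (suc-injective ∘ π-inj) large′
      where
      large′ : ∀ l → p * n + Q * nbad + Q * k ≤ Q * commonIn (w ∷ κ) (π (suc l))
      large′ l = +-cancelˡ-≤ n _ _ (begin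
        n + (p * n + Q * nbad + Q * k)                          ≡⟨ sym (+-assoc n _ (Q * k)) ⟩
        n + (p * n + Q * nbad) + Q * k                          ≡⟨ cong (_+ Q * k) (sym (+-assoc n (p * n) _)) ⟩
        suc p * n + Q * nbad + Q * k                            ≤⟨ large (suc l) ⟩
        Q * commonIn κ (π (suc l))
          ≤⟨ *-monoʳ-≤ Q (commonIn-extend κ w _ λ eq → 0≢1+n (π-inj (trans (sym w-part) eq))) ⟩
        Q * (commonIn (w ∷ κ) (π (suc l)) + crossMiss G c w)    ≡⟨ *-distribˡ-+ Q _ _ ⟩
        Q * commonIn (w ∷ κ) (π (suc l)) + Q * crossMiss G c w  ≤⟨ +-monoʳ-≤ _ w-good ⟩
        Q * commonIn (w ∷ κ) (π (suc l)) + n                    ≡⟨ +-comm _ n ⟩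
        n + Q * commonIn (w ∷ κ) (π (suc l))                    ∎)
        where open ≤-Reasoning

  -- The hypotheses of the theorem with √ε replaced by 1 / Q and denominators cleared.
  module MaxCutPartition {r′ k n : ℕ} (G : Graph n) (c : Fin n → Fin (2 + r′)) (Q : ℕ) (k≥1 : 1 ≤ k)
    (extremal : Extremal (2 + r′) k G)
    (max-cut : ∀ (c′ : Fin n → Fin (2 + r′)) → crossSum G c′ ≤ crossSum G c)
    (inSum-small : 2 * (Q * Q) * inSum G c ≤ n * n)
    (parts-large : ∀ j → Q * n < (2 + r′) * Q * card (part c j) + 2 * n * (2 + r′))
    (Q-large : (2 + r′) * (3 * r′ + 21) + 1 ≤ Q)
    (n-large : (2 + r′) * (12 * (Q * Q) + 3 * Q * k) + 2 * (2 + r′) * Q ≤ n) where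

    private
      r = 2 + r′
      A = adj G

    -- u ∉ L, with √ε replaced by 1 / Q.
    HighDeg : Fin n → Set
    HighDeg u = r * Q * n < Q * n + r * Q * deg G u + 5 * n * r

    private
      2r+1≤Q : 2 * r + 1 ≤ Q
      2r+1≤Q = ≤-trans (+-monoˡ-≤ 1 (≤-trans (≤-reflexive (*-comm 2 r)) (*-monoʳ-≤ r 2≤3r′+21))) Q-large
        where
        2≤3r′+21 : 2 ≤ 3 * r′ + 21
        2≤3r′+21 = ≤-trans (s≤s (s≤s z≤n)) (m≤n+m 21 (3 * r′))

      Q≥1 : 1 ≤ Q
      Q≥1 = ≤-trans (m≤n+m 1 (2 * r)) 2r+1≤Q

      n≥2rQ : 2 * r * Q ≤ n
      n≥2rQ = ≤-trans (m≤n+m (2 * r * Q) (r * (12 * (Q * Q) + 3 * Q * k))) n-large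

    part-has-3 : ∀ j → 3 ≤ card (part c j)
    part-has-3 j with 3 ≤? card (part c j)
    ... | yes 3≤ = 3≤
    ... | no  3≰ = contradiction (parts-large j) (too-small (≤-pred (≰⇒> 3≰)))
      where
      too-small : ∀ {s} → s ≤ 2 → ¬ (Q * n < r * Q * s + 2 * n * r)
      too-small {s} s≤2 = ≤⇒≯ (begin
        r * Q * s + 2 * n * r    ≤⟨ +-monoˡ-≤ (2 * n * r) (*-monoʳ-≤ (r * Q) s≤2) ⟩
        r * Q * 2 + 2 * n * r    ≡⟨ e₁ r Q n ⟩
        2 * r * Q + 2 * r * n    ≤⟨ +-monoˡ-≤ (2 * r * n) n≥2rQ ⟩
        n + 2 * r * n            ≡⟨ e₂ r n ⟩
        (2 * r + 1) * n          ≤⟨ *-monoˡ-≤ n 2r+1≤Q ⟩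
        Q * n                    ∎)
        where
        open ≤-Reasoning
        e₁ : ∀ r Q n → r * Q * 2 + 2 * n * r ≡ 2 * r * Q + 2 * r * n
        e₁ = solve-∀
        e₂ : ∀ r n → n + 2 * r * n ≡ (2 * r + 1) * n
        e₂ = solve-∀

    private
      three-in : ∀ j → Σ (Fin 3 → Fin n) λ g → Injective _≡_ _≡_ g × (∀ x → (c (g x) == j) ≡ true)
      three-in j = distinct-witnesses 3 (λ b → c b == j) (subst (3 ≤_) (count-allFin (part c j)) (part-has-3 j))

      representative : Ty r′ → Fin n
      representative (cyc a) = proj₁ (three-in (partSide a ↑ˡ r′)) (sideIndex a)
      representative (tp j)  = proj₁ (three-in (suc (suc j))) 0F

      representative-part : ∀ t → c (representative t) ≡ partOf t
      representative-part (cyc a) = ==⇒≡ (proj₂ (proj₂ (three-in (partSide a ↑ˡ r′))) (sideIndex a))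
      representative-part (tp j)  = ==⇒≡ (proj₂ (proj₂ (three-in (suc (suc j)))) 0F)

      representative-cyc-injective : ∀ a b → representative (cyc a) ≡ representative (cyc b) → a ≡ b
      representative-cyc-injective a b eq = side-position-injective a b same-side (proj₁ (proj₂ (three-in _)) eq′)
        where
        same-side : partSide a ≡ partSide b
        same-side = ↑ˡ-injective r′ _ _
          (trans (sym (representative-part (cyc a))) (trans (cong c eq) (representative-part (cyc b))))
        eq′ : proj₁ (three-in (partSide a ↑ˡ r′)) (sideIndex a) ≡ proj₁ (three-in (partSide a ↑ˡ r′)) (sideIndex b)
        eq′ = trans eq (cong (λ x → proj₁ (three-in (x ↑ˡ r′)) (sideIndex b)) (sym same-side))

    open ComparisonGraph c representative representative-part representative-cyc-injective
      using (H; τ; τ-section; cross-pairs-covered; ∑∑-extra)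

    crossMiss-total : ∑[ w < n ] crossMiss G c w ≤ 2 * inSum G c + 4 * n
    crossMiss-total = subst (λ e → ∑[ w < n ] crossMiss G c w ≤ 2 * inSum G c + e) ∑∑-extra
      (crossMiss-∑-≤ G c H _ H≤G cross-pairs-covered)
      where
      H≤G : edges H ≤ edges G
      H≤G = proj₂ (proj₂ extremal) H (blowUp-not-partite τ representative τ-section) (blowUp-BFree k k≥1 τ)

    open GreedyBook G c (proj₁ (proj₂ extremal)) Q k≥1 Q≥1

    few-bad : Q * nbad ≤ n + 4 * (Q * Q)
    few-bad = *-cancelˡ-≤ (suc n) (begin
      suc n * (Q * nbad)                 ≡⟨ *-comm (suc n) _ ⟩
      Q * nbad * suc n                   ≡⟨ *-assoc Q nbad (suc n) ⟩
      Q * (nbad * suc n)                 ≤⟨ *-monoʳ-≤ Q (≤-trans (≤-reflexive (*-comm nbad (suc n))) bad-weight) ⟩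
      Q * (Q * ∑[ w < n ] crossMiss G c w) ≤⟨ *-monoʳ-≤ Q (*-monoʳ-≤ Q crossMiss-total) ⟩
      Q * (Q * (2 * inSum G c + 4 * n))  ≡⟨ e₁ Q (inSum G c) n ⟩
      2 * (Q * Q) * inSum G c + 4 * n * (Q * Q) ≤⟨ +-monoˡ-≤ _ inSum-small ⟩
      n * n + 4 * n * (Q * Q)            ≤⟨ m≤m+n _ _ ⟩
      n * n + 4 * n * (Q * Q) + (n + 4 * (Q * Q)) ≡⟨ e₂ n Q ⟩
      suc n * (n + 4 * (Q * Q))          ∎)
      where
      open ≤-Reasoning
      e₁ : ∀ Q I n → Q * (Q * (2 * I + 4 * n)) ≡ 2 * (Q * Q) * I + 4 * n * (Q * Q)
      e₁ = solve-∀
      e₂ : ∀ n Q → n * n + 4 * n * (Q * Q) + (n + 4 * (Q * Q)) ≡ suc n * (n + 4 * (Q * Q))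
      e₂ = solve-∀
      bad-pointwise : ∀ w → suc n * 𝟙 (not (good w)) ≤ Q * crossMiss G c w
      bad-pointwise w with good w in g
      ... | true  = ≤-trans (≤-reflexive (*-zeroʳ (suc n))) z≤n
      ... | false = ≤-trans (≤-reflexive (*-identityʳ (suc n)))
                            (≰⇒> λ Qm≤n → contradiction (trans (sym g) (Equivalence.to T-≡ (≤⇒≤ᵇ Qm≤n))) λ ())
      bad-weight : suc n * nbad ≤ Q * ∑[ w < n ] crossMiss G c w
      bad-weight = begin
        suc n * nbad                                 ≡⟨ *-distribˡ-sum {n} (suc n) _ ⟩
        ∑[ w < n ] (suc n * 𝟙 (not (good w)))       ≤⟨ ∑-mono-≤ bad-pointwise ⟩
        ∑[ w < n ] (Q * crossMiss G c w)            ≡⟨ sym (*-distribˡ-sum {n} Q _) ⟩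
        Q * ∑[ w < n ] crossMiss G c w               ∎

    own-small : ∀ x → Q * partDeg G c x (c x) < suc r′ * n + Q * nbad + Q * k
    own-small x = ≰⇒> λ large → greedy-book (suc r′) 1 (x ∷ []) refl (single-clique x) id id λ l →
      ≤-trans large (*-monoʳ-≤ Q (own≤common l))
      where
      own≤common : ∀ l → partDeg G c x (c x) ≤ commonIn (x ∷ []) l
      own≤common l = ≤-trans (ownDeg≤partDeg G c x l (max-cut (moveTo c x l))) (≤-reflexive (sum-cong-≗ {n} λ b →
        cong 𝟙 (trans (∧-comm (A x b) (c b == l)) (cong ((c b == l) ∧_) (sym (∧-identityʳ (A x b)))))))

    few-misses : ∀ x → HighDeg x → Q * crossMiss G c x < Q * partDeg G c x (c x) + 7 * n
    few-misses x high =
      subst (λ z → Q * m < Q * t + 7 * z) (card-split G c x) (*-cancelˡ-< r _ _ (+-cancelˡ-< X _ _ combined))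
      where
      s = card (part c (c x))
      d = crossDeg G c x
      m = crossMiss G c x
      t = partDeg G c x (c x)
      size : Q * (s + d + m) < r * Q * s + 2 * (s + d + m) * r
      size = subst (λ z → Q * z < r * Q * s + 2 * z * r) (sym (card-split G c x)) (parts-large (c x))
      high′ : r * Q * (s + d + m) < Q * (s + d + m) + r * Q * (t + d) + 5 * (s + d + m) * r
      high′ = subst₂ (λ z e → r * Q * z < Q * z + r * Q * e + 5 * z * r) (sym (card-split G c x)) (deg-split G c x) high
      X = Q * (s + d + m) + r * Q * s + r * Q * d
      e₁ : ∀ Q s d m r → Q * (s + d + m) + r * Q * (s + d + m) ≡ (Q * (s + d + m) + r * Q * s + r * Q * d) + r * (Q * m)
      e₁ = solve-∀
      e₂ : ∀ r Q s d m t → r * Q * s + 2 * (s + d + m) * r + (Q * (s + d + m) + r * Q * (t + d) + 5 * (s + d + m) * r)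
                          ≡ (Q * (s + d + m) + r * Q * s + r * Q * d) + r * (Q * t + 7 * (s + d + m))
      e₂ = solve-∀
      combined : X + r * (Q * m) < X + r * (Q * t + 7 * (s + d + m))
      combined = subst₂ _<_ (e₁ Q s d m r) (e₂ r Q s d m t) (+-mono-< size high′)

    misses-bounded : ∀ x → HighDeg x → Q * crossMiss G c x ≤ suc r′ * n + Q * nbad + Q * k + 7 * n
    misses-bounded x high = ≤-trans (<⇒≤ (few-misses x high)) (+-monoˡ-≤ (7 * n) (<⇒≤ (own-small x)))

    pair-common≥ : ∀ u v → c u ≡ c v → ∀ j → j ≢ c u →
      card (part c j) ≤ commonIn (u ∷ v ∷ []) j + crossMiss G c u + crossMiss G c v
    pair-common≥ u v same j j≢cu = begin
      card (part c j)                            ≡⟨ count-allFin (part c j) ⟩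
      ∑[ b < n ] 𝟙 (c b == j)                    ≤⟨ ∑-mono-≤ pointwise ⟩
      ∑[ b < n ] (𝟙 ((c b == j) ∧ commonNbr (u ∷ v ∷ []) b) + 𝟙 (not (c u == c b) ∧ not (A u b))
                                                           + 𝟙 (not (c v == c b) ∧ not (A v b)))
        ≡⟨ trans (∑-distrib-+ {n} _ _) (cong (_+ crossMiss G c v) (∑-distrib-+ {n} _ _)) ⟩
      commonIn (u ∷ v ∷ []) j + crossMiss G c u + crossMiss G c v ∎
      where
      open ≤-Reasoning
      covers : ∀ x y → 1 ≤ 𝟙 (x ∧ (y ∧ true)) + 𝟙 (not x) + 𝟙 (not y)
      covers true  true  = ≤-refl
      covers true  false = ≤-refl
      covers false y     = s≤s z≤n
      pointwise : ∀ b → 𝟙 (c b == j) ≤ 𝟙 ((c b == j) ∧ commonNbr (u ∷ v ∷ []) b) + 𝟙 (not (c u == c b) ∧ not (A u b))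
                                                                              + 𝟙 (not (c v == c b) ∧ not (A v b))
      pointwise b with c b == j in b∈j
      ... | false = z≤n
      ... | true rewrite ≢⇒==-false {x = c u} {c b} (λ eq → j≢cu (sym (trans eq (==⇒≡ b∈j))))
                       | ≢⇒==-false {x = c v} {c b} (λ eq → j≢cu (sym (trans same (trans eq (==⇒≡ b∈j)))))
        = covers (A u b) (A v b)

    pair-common-large : ∀ u v → c u ≡ c v → HighDeg u → HighDeg v → ∀ j → j ≢ c u →
      r′ * n + Q * nbad + Q * k ≤ Q * commonIn (u ∷ v ∷ []) j
    pair-common-large u v same high-u high-v j j≢cu with r′ * n + Q * nbad + Q * k ≤? Q * commonIn (u ∷ v ∷ []) j
    ... | yes enough = enough
    ... | no  few    = contradiction (parts-large j) (≤⇒≯ (begin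
      r * Q * s + 2 * n * r                                          ≡⟨ cong (_+ 2 * n * r) (*-assoc r Q s) ⟩
      r * (Q * s) + 2 * n * r                                        ≤⟨ +-monoˡ-≤ (2 * n * r) (*-monoʳ-≤ r Qs≤) ⟩
      r * ((3 * r′ + 19) * n + 12 * (Q * Q) + 3 * Q * k) + 2 * n * r ≡⟨ e₁ r r′ n Q k ⟩
      r * (3 * r′ + 21) * n + r * (12 * (Q * Q) + 3 * Q * k)         ≤⟨ +-monoʳ-≤ _ (≤-trans (m≤m+n _ _) n-large) ⟩
      r * (3 * r′ + 21) * n + n                                      ≡⟨ e₂ r r′ n ⟩
      (r * (3 * r′ + 21) + 1) * n                                    ≤⟨ *-monoˡ-≤ n Q-large ⟩
      Q * n                                                          ∎))
      where
      open ≤-Reasoning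
      s = card (part c j)
      M = Q * nbad
      e₁ : ∀ r r′ n Q k → r * ((3 * r′ + 19) * n + 12 * (Q * Q) + 3 * Q * k) + 2 * n * r
                        ≡ r * (3 * r′ + 21) * n + r * (12 * (Q * Q) + 3 * Q * k)
      e₁ = solve-∀
      e₂ : ∀ r r′ n → r * (3 * r′ + 21) * n + n ≡ (r * (3 * r′ + 21) + 1) * n
      e₂ = solve-∀
      e₃ : ∀ r′ n M Q k → (r′ * n + M + Q * k) + ((1 + r′) * n + M + Q * k + 7 * n) + ((1 + r′) * n + M + Q * k + 7 * n)
                        ≡ (3 * r′ + 16) * n + 3 * M + 3 * (Q * k)
      e₃ = solve-∀
      e₄ : ∀ r′ n Q k → (3 * r′ + 16) * n + 3 * (n + 4 * (Q * Q)) + 3 * (Q * k) ≡ (3 * r′ + 19) * n + 12 * (Q * Q) + 3 * Q * k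
      e₄ = solve-∀
      Qs≤ : Q * s ≤ (3 * r′ + 19) * n + 12 * (Q * Q) + 3 * Q * k
      Qs≤ = begin
        Q * s                                                       ≤⟨ *-monoʳ-≤ Q (pair-common≥ u v same j j≢cu) ⟩
        Q * (commonIn (u ∷ v ∷ []) j + crossMiss G c u + crossMiss G c v)
          ≡⟨ trans (*-distribˡ-+ Q _ _) (cong (_+ Q * crossMiss G c v) (*-distribˡ-+ Q _ _)) ⟩
        Q * commonIn (u ∷ v ∷ []) j + Q * crossMiss G c u + Q * crossMiss G c v
          ≤⟨ +-mono-≤ (+-mono-≤ (<⇒≤ (≰⇒> few)) (misses-bounded u high-u)) (misses-bounded v high-v) ⟩
        (r′ * n + M + Q * k) + (suc r′ * n + M + Q * k + 7 * n) + (suc r′ * n + M + Q * k + 7 * n)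
          ≡⟨ e₃ r′ n M Q k ⟩
        (3 * r′ + 16) * n + 3 * M + 3 * (Q * k)
          ≤⟨ +-monoˡ-≤ (3 * (Q * k)) (+-monoʳ-≤ ((3 * r′ + 16) * n) (*-monoʳ-≤ 3 few-bad)) ⟩
        (3 * r′ + 16) * n + 3 * (n + 4 * (Q * Q)) + 3 * (Q * k)     ≡⟨ e₄ r′ n Q k ⟩
        (3 * r′ + 19) * n + 12 * (Q * Q) + 3 * Q * k                ∎

    no-edge-between-high-degree : ∀ u v → adj G u v ≡ true → c u ≡ c v → HighDeg u → HighDeg v → ⊥
    no-edge-between-high-degree u v u~v same high-u high-v =
      greedy-book r′ 2 (u ∷ v ∷ []) refl (clique-extend (single-clique v) (cong (_∧ true) (trans (Graph.sym G v u) u~v)))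
        (punchIn (c u)) (punchIn-injective (c u) _ _)
        λ l → pair-common-large u v same high-u high-v (punchIn (c u) l) (punchInᵢ≢i (c u) l)


open import Defs hiding (sym)
open Counting using (==⇒≡; ∧-≡true; not≡true⇒≡false)
open EdgeCounting using (independent⇒eIn≡0)
open RationalBounds using (inSum-bound; part-size-bound; ∉L-degree-bound)
open import Data.Bool using (true; false; _∧_; not)
open import Data.Fin using (Fin)
open import Data.Nat using (ℕ; zero; suc; pred; _+_; _≤_; _*_; _^_; s≤s)
open import Data.Nat.Properties using (m≤m+n; ≤-trans; ≤-reflexive; ^-distribˡ-+-*)
open import Data.Nat.Tactic.RingSolver using (solve-∀)
open import Data.Product using (Σ; _×_; _,_; proj₁; proj₂)
open import Data.Rational using (ℚ; 0ℚ; _<_; _-_) renaming (_≤_ to _≤ℚ_; _*_ to _*ℚ_)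
open import Relation.Binary.PropositionalEquality
open import Function using (_∘_)

high-degree-parts-independent : ∀ {r′ k n} q ε → ε < recip (suc q * suc q) →
  (2 + r′) * (3 * r′ + 21) + 1 ≤ suc q → 1 ≤ k →
  (2 + r′) * (12 * (suc q * suc q) + 3 * suc q * k) + 2 * (2 + r′) * suc q ≤ n →
  (G : Graph n) → Extremal (2 + r′) k G →
  (c : Fin n → Fin (2 + r′)) → (∀ (c′ : Fin n → Fin (2 + r′)) → crossSum G c′ ≤ crossSum G c) →
  ℕtoℚ (inSum G c) ≤ℚ (ε *ℚ recip 2) *ℚ ℕtoℚ (n * n) →
  (∀ j → LtSqrt (recip (2 + r′) *ℚ ℕtoℚ n - ℕtoℚ (card (part c j))) (ℕtoℚ (2 * n)) ε) →
  (i : Fin (2 + r′)) → eIn G (λ v → part c i v ∧ not (inL (2 + r′) ε G v)) ≡ 0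
high-degree-parts-independent {r′} {k} {n} q ε ε<1/Q² Q-large k≥1 n-large G extremal c max-cut inSum≤ deficits i =
  independent⇒eIn≡0 G _ λ u v u~v u∈ v∈ →
    no-edge-between-high-degree u v u~v (trans (in-part u∈) (sym (in-part v∈))) (high u∈) (high v∈)
  where
  open ExtremalStructure.MaxCutPartition G c (suc q) k≥1 extremal max-cut (inSum-bound q (inSum G c) (n * n) ε ε<1/Q² inSum≤)
    (λ j → part-size-bound (suc r′) q n (card (part c j)) ε ε<1/Q² (deficits j)) Q-large n-large
  in-part : ∀ {u} → (part c i u ∧ not (inL (2 + r′) ε G u)) ≡ true → c u ≡ i
  in-part {u} u∈ = ==⇒≡ (proj₁ (∧-≡true {part c i u} u∈))
  high : ∀ {u} → (part c i u ∧ not (inL (2 + r′) ε G u)) ≡ true → HighDeg u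
  high {u} u∈ = ∉L-degree-bound (suc r′) q n (deg G u) ε ε<1/Q² (not≡true⇒≡false (proj₂ (∧-≡true {part c i u} u∈)))

lemma3p4 : (r k : ℕ) → 3 ≤ r → 1 ≤ k →
  (ε : ℚ) → 0ℚ < ε → ε < recip (36 * r ^ 8) →
  Σ ℕ λ N → (n : ℕ) → N ≤ n →
  (G : Graph n) → Extremal r k G →
  (c : Fin n → Fin r) →
  (∀ (c′ : Fin n → Fin r) → crossSum G c′ ≤ crossSum G c) →
  ℕtoℚ (inSum G c) ≤ℚ (ε *ℚ recip 2) *ℚ ℕtoℚ (n * n) →
  (∀ (i : Fin r) →
    LtSqrt (recip r *ℚ ℕtoℚ n - ℕtoℚ (card (part c i))) (ℕtoℚ (2 * n)) ε
    × LtSqrt (ℕtoℚ (card (part c i)) - recip r *ℚ ℕtoℚ n) (ℕtoℚ (2 * n)) ε) →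
  (i : Fin r) → eIn G (λ v → part c i v ∧ not (inL r ε G v)) ≡ 0
lemma3p4 (suc zero) _ (s≤s ())
lemma3p4 (suc (suc r′)) k _ k≥1 ε _ ε<1/36r⁸ =
  r * (12 * (Q * Q) + 3 * Q * k) + 2 * r * Q , λ n N≤n G extremal c max-cut inSum≤ sizes →
    high-degree-parts-independent q ε ε<1/Q² Q-large k≥1 N≤n G extremal c max-cut inSum≤ (proj₁ ∘ sizes)
  where
  r = 2 + r′
  -- Q = 6 r⁴, so that √ε < 1 / Q; it is written as a successor because recip computes only on
  -- successors, and suc (pred (6 * r ^ 4)) reduces to 6 * r ^ 4.
  q = pred (6 * r ^ 4)
  Q = suc q
  ε<1/Q² : ε < recip (Q * Q)
  ε<1/Q² = subst (λ m → ε < recip m) (trans (cong (36 *_) (^-distribˡ-+-* r 4 4)) (square (r ^ 4))) ε<1/36r⁸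
    where
    square : ∀ a → 36 * (a * a) ≡ 6 * a * (6 * a)
    square = solve-∀
  Q-large : r * (3 * r′ + 21) + 1 ≤ Q
  Q-large = ≤-trans (m≤m+n _ _) (≤-reflexive (slack r′))
    where
    slack : ∀ x → (2 + x) * (3 * x + 21) + 1 + (6 * (x * x * x * x) + 48 * (x * x * x) + 141 * (x * x) + 165 * x + 53)
                ≡ 6 * ((2 + x) * ((2 + x) * ((2 + x) * ((2 + x) * 1))))
    slack = solve-∀
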